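{- Let $\mathrm{OPT}$ be the optimal makespan of the Train Makespan Optimization instance $(D,\tau,d,\Delta)$. Then there exists a flow over time $f$ in $D$ with unit arc capacities and transit times $\tau$, with time horizon $\mathrm{OPT}+\Delta$ and value $d\cdot\Delta$.
   Context: Train Makespan Optimization: given a directed graph $D=(V,A)$ with travel times $\tau_a\in\mathbb{Z}_{\ge0}$, source $s$, sink $t$, a number $d$ of trains and headway $\Delta\in\mathbb{Z}_{\ge1}$, find $s$-$t$-paths $P_1,\dots,P_d$ and entry times $\lambda_i:P_i\to\mathbb{Z}_{\ge0}$ with $\lambda_i(a)+\tau_a\le\lambda_i(a')$ for consecutive arcs $a,a'$ of $P_i$ and $|\lambda_i(a)-\lambda_{i'}(a)|\ge\Delta$ for $i\ne i'$, $a\in P_i\cap P_{i'}$, minimizing the makespan $\max_i\max_{a\in P_i}(\lambda_i(a)+\tau_a)$. A flow over time with time horizon $T$ in a network with capacities and transit times sends flow from $s$ to $t$ over time: flow entering arc $a$ at time $\theta$ at rate at most the capacity of $a$ arrives at its head at time $\theta+\tau_a$, flow is conserved at intermediate nodes, and all flow must arrive at $t$ by time $T$; its value is the total amount arriving at $t$. -}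

module Defs where

open import Data.Nat using (ℕ; zero; suc; _+_; _*_; _∸_; _≤_; _<_; _⊔_; ∣_-_∣; _≤?_)
open import Data.Fin using (Fin)
open import Data.Fin.Properties using (_≟_)
open import Data.List using (List; []; _∷_; map; foldr; upTo; allFin)
open import Data.Nat.ListAction using (sum)
open import Data.List.Membership.Propositional using (_∈_)
open import Data.List.Relation.Unary.Unique.Propositional using (Unique)
open import Data.Product using (_×_; Σ; ∃)
open import Data.Unit using (⊤)
open import Relation.Nullary using (¬_; yes; no)
open import Relation.Nullary.Decidable using (⌊_⌋)
open import Relation.Binary.PropositionalEquality using (_≡_)

record Network : Set where
  field
    n   : ℕ
    m   : ℕ
    src : Fin m → Fin n
    tgt : Fin m → Fin n
    τ   : Fin m → ℕ

module _ (D : Network) where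
  open Network D

  Connects : Fin n → List (Fin m) → Fin n → Set
  Connects u []      v = u ≡ v
  Connects u (a ∷ P) v = src a ≡ u × Connects (tgt a) P v

  vertices : Fin n → List (Fin m) → List (Fin n)
  vertices u []      = u ∷ []
  vertices u (a ∷ P) = u ∷ vertices (tgt a) P

  IsSTPath : Fin n → Fin n → List (Fin m) → Set
  IsSTPath s t P = Connects s P t × Unique (vertices s P)

  TimingOK : (Fin m → ℕ) → List (Fin m) → Set
  TimingOK lam []            = ⊤
  TimingOK lam (a ∷ [])      = ⊤
  TimingOK lam (a ∷ a' ∷ P)  = lam a + τ a ≤ lam a' × TimingOK lam (a' ∷ P)

  -- A train schedule for d trains: paths P_i and entry times λ_i
  -- (λ_i is only relevant on the arcs of P_i).
  record Schedule (d : ℕ) : Set where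
    field
      path  : Fin d → List (Fin m)
      entry : Fin d → Fin m → ℕ

  module _ {d : ℕ} (S : Schedule d) where
    open Schedule S

    Feasible : Fin n → Fin n → ℕ → Set
    Feasible s t Δ =
      ((i : Fin d) → IsSTPath s t (path i) × TimingOK (entry i) (path i)) ×
      ((i i' : Fin d) → ¬ (i ≡ i') → (a : Fin m) → a ∈ path i → a ∈ path i' →
         Δ ≤ ∣ entry i a - entry i' a ∣)

    -- max_i max_{a ∈ P_i} (λ_i(a) + τ_a)   (0 if there are no arcs at all)
    makespan : ℕ
    makespan = foldr _⊔_ 0
      (map (λ i → foldr _⊔_ 0 (map (λ a → entry i a + τ a) (path i))) (allFin d))

  IsOptimalMakespan : Fin n → Fin n → (d Δ : ℕ) → ℕ → Set
  IsOptimalMakespan s t d Δ OPT =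
    Σ (Schedule d) (λ S → Feasible S s t Δ × makespan S ≡ OPT) ×
    ((S : Schedule d) → Feasible S s t Δ → OPT ≤ makespan S)

  -- Flows over time (unit capacities, transit times τ), in discrete
  -- time: f a θ is the (constant) rate at which flow enters arc a
  -- during [θ, θ+1); it arrives at tgt a during [θ+τ_a, θ+τ_a+1).

  sumArcs : (Fin m → ℕ) → ℕ
  sumArcs g = sum (map g (allFin m))

  inflow : (Fin m → ℕ → ℕ) → Fin n → ℕ → ℕ
  inflow f v θ = sumArcs λ a → helper a (tgt a ≟ v) (τ a ≤? θ)
    where
    helper : (a : Fin m) → _ → _ → ℕ
    helper a (yes _) (yes _) = f a (θ ∸ τ a)
    helper a _       _       = 0

  outflow : (Fin m → ℕ → ℕ) → Fin n → ℕ → ℕ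
  outflow f v θ = sumArcs λ a → helper a (src a ≟ v)
    where
    helper : (a : Fin m) → _ → ℕ
    helper a (yes _) = f a θ
    helper a (no _)  = 0

  record FlowOverTime (s t : Fin n) (T : ℕ) (value : ℕ) : Set where
    field
      f            : Fin m → ℕ → ℕ
      capacity     : (a : Fin m) (θ : ℕ) → f a θ ≤ 1
      horizon      : (a : Fin m) (θ : ℕ) → T < suc (θ + τ a) → f a θ ≡ 0
      conservation : (v : Fin n) → ¬ (v ≡ s) → ¬ (v ≡ t) → (θ : ℕ) →
                     inflow f v θ ≡ outflow f v θ
      hasValue     : sum (map (inflow f t) (upTo T)) ≡
                     sum (map (outflow f t) (upTo T)) + value

module Submission where

-- Let T = OPT + Δ.  A primal-dual minimum-cost flow computation yields a 0/1 static s-t flow x and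
-- node potentials p with p s = 0 and p t = T satisfying complementary slackness.  Repeating the
-- paths of a decomposition of x for as long as they still reach t by time T gives a flow over time
-- (Ford–Fulkerson) of value Σₐ (p (tgt a) − p (src a) − τ a)⁺, the total slack of p.  Conversely,
-- for each train i and offset j < Δ, the train's path entered at the times λᵢ + j starts at
-- potential 0 and reaches t before time T, so it enters some arc a no earlier than p (src a) and
-- leaves it before p (tgt a).  By the headway condition these d · Δ crossings use distinct time
-- steps of each arc's window, so d · Δ is at most the total slack, and the repeated flow can be
-- stopped at value exactly d · Δ.

open import Defs
open import Data.Bool.Base using (Bool; true; false; not)
import Data.Bool.Properties as Bool
open import Data.Empty using (⊥; ⊥-elim)
open import Data.Fin.Base using (Fin; zero; suc)
open import Data.Fin.Properties using (_≟_; any?; suc-injective)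
open import Data.List.Base using (List; []; _∷_; _++_; [_]; map; foldr; filter; upTo; allFin; length)
open import Data.List.Membership.Propositional using (_∈_; _∉_)
open import Data.List.Membership.Propositional.Properties using (∈-filter⁺; ∈-filter⁻; ∈-allFin; ∈-upTo⁺; ∈-upTo⁻)
open import Data.List.Properties
  using (length-upTo; length-tabulate; length-filter; filter-notAll; map-tabulate; map-++; upTo-∷ʳ)
open import Data.List.Relation.Unary.All as All using (All; []; _∷_)
open import Data.List.Relation.Unary.All.Properties using (All¬⇒¬Any; map⁻; map⁺)
open import Data.List.Relation.Unary.AllPairs using ([]; _∷_)
open import Data.List.Relation.Unary.Any as Any using (here; there)
open import Data.List.Relation.Unary.Unique.Propositional using (Unique)
open import Data.List.Relation.Unary.Unique.Propositional.Properties using (upTo⁺)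
open import Data.Nat.Base
open import Data.Nat.ListAction using (sum)
open import Data.Nat.ListAction.Properties using (sum-++)
open import Data.Nat.Properties hiding (_≟_; suc-injective)
import Data.Nat.Properties as ℕ
open import Algebra.Properties.CommutativeSemigroup +-commutativeSemigroup
  using (interchange; xy∙z≈zy∙x; xy∙z≈x∙zy; xy∙z≈xz∙y)
open import Data.Nat.Tactic.RingSolver using (solve-∀)
open import Data.Product.Base using (_×_; _,_; Σ; ∃; proj₁; proj₂)
open import Data.Sum.Base using (_⊎_; inj₁; inj₂)
open import Data.Unit.Base using (⊤; tt)
open import Function.Base using (_∘_; id; case_of_)
open import Relation.Binary.Definitions using (DecidableEquality)
open import Relation.Binary.PropositionalEquality hiding ([_])
open import Relation.Nullary using (¬_; Dec; yes; no; does; ¬?)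
open import Relation.Nullary.Decidable using (dec-true; dec-false; decidable-stable; _×-dec_)
open import Relation.Unary using (Decidable)

bit : Bool → ℕ
bit true  = 1
bit false = 0

bit≤1 : ∀ b → bit b ≤ 1
bit≤1 true  = ≤-refl
bit≤1 false = z≤n

module _ {A : Set} where

  𝟙 : Dec A → ℕ
  𝟙 a? = bit (does a?)

  𝟙-yes : (a? : Dec A) → A → 𝟙 a? ≡ 1
  𝟙-yes a? a = cong bit (dec-true a? a)

  𝟙-no : (a? : Dec A) → ¬ A → 𝟙 a? ≡ 0
  𝟙-no a? ¬a = cong bit (dec-false a? ¬a)

  𝟙≤1 : (a? : Dec A) → 𝟙 a? ≤ 1
  𝟙≤1 a? = bit≤1 (does a?)

  𝟙>0⇒ : (a? : Dec A) → 0 < 𝟙 a? → A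
  𝟙>0⇒ (yes a) _ = a

  does≡true⇒ : (a? : Dec A) → does a? ≡ true → A
  does≡true⇒ (yes a) _ = a

module _ {A B : Set} where

  𝟙-cong : (A → B) → (B → A) → (a? : Dec A) (b? : Dec B) → 𝟙 a? ≡ 𝟙 b?
  𝟙-cong f g a? (yes b) = 𝟙-yes a? (g b)
  𝟙-cong f g a? (no ¬b) = 𝟙-no a? (λ a → ¬b (f a))

  𝟙-* : (a? : Dec A) (b? : Dec B) → 𝟙 a? * 𝟙 b? ≡ 𝟙 (a? ×-dec b?)
  𝟙-* (yes _) (yes _) = refl
  𝟙-* (yes _) (no _)  = refl
  𝟙-* (no _)  _       = refl

∑ : {A : Set} → List A → (A → ℕ) → ℕ
∑ xs f = sum (map f xs)

infixl 10 ∑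
syntax ∑ xs (λ x → e) = ∑[ x ∈ xs ] e

module _ {A : Set} where

  ∑-cong-∈ : ∀ xs {f g : A → ℕ} → (∀ x → x ∈ xs → f x ≡ g x) → ∑ xs f ≡ ∑ xs g
  ∑-cong-∈ []       eq = refl
  ∑-cong-∈ (x ∷ xs) eq = cong₂ _+_ (eq x (here refl)) (∑-cong-∈ xs (λ y y∈ → eq y (there y∈)))

  ∑-cong : ∀ xs {f g : A → ℕ} → (∀ x → f x ≡ g x) → ∑ xs f ≡ ∑ xs g
  ∑-cong xs eq = ∑-cong-∈ xs (λ x _ → eq x)

  ∑-mono-∈ : ∀ xs {f g : A → ℕ} → (∀ x → x ∈ xs → f x ≤ g x) → ∑ xs f ≤ ∑ xs g
  ∑-mono-∈ []       le = z≤n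
  ∑-mono-∈ (x ∷ xs) le = +-mono-≤ (le x (here refl)) (∑-mono-∈ xs (λ y y∈ → le y (there y∈)))

  ∑-mono : ∀ xs {f g : A → ℕ} → (∀ x → f x ≤ g x) → ∑ xs f ≤ ∑ xs g
  ∑-mono xs le = ∑-mono-∈ xs (λ x _ → le x)

  ∑-zero-∈ : ∀ xs {f : A → ℕ} → (∀ x → x ∈ xs → f x ≡ 0) → ∑ xs f ≡ 0
  ∑-zero-∈ []       eq = refl
  ∑-zero-∈ (x ∷ xs) eq = cong₂ _+_ (eq x (here refl)) (∑-zero-∈ xs (λ y y∈ → eq y (there y∈)))

  ∑-zero : ∀ xs {f : A → ℕ} → (∀ x → f x ≡ 0) → ∑ xs f ≡ 0
  ∑-zero xs eq = ∑-zero-∈ xs (λ x _ → eq x)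

  ∑-const : ∀ xs c → ∑ xs (λ (_ : A) → c) ≡ length xs * c
  ∑-const []       c = refl
  ∑-const (x ∷ xs) c = cong (c +_) (∑-const xs c)

  ∑-distrib-+ : ∀ xs (f g : A → ℕ) → ∑[ x ∈ xs ] (f x + g x) ≡ ∑ xs f + ∑ xs g
  ∑-distrib-+ []       f g = refl
  ∑-distrib-+ (x ∷ xs) f g =
    trans (cong (f x + g x +_) (∑-distrib-+ xs f g)) (interchange (f x) (g x) (∑ xs f) (∑ xs g))

  ∑-distribˡ : ∀ xs c (f : A → ℕ) → c * ∑ xs f ≡ ∑[ x ∈ xs ] (c * f x)
  ∑-distribˡ []       c f = *-zeroʳ c
  ∑-distribˡ (x ∷ xs) c f = trans (*-distribˡ-+ c (f x) _) (cong (c * f x +_) (∑-distribˡ xs c f))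

  ∈⇒≤∑ : ∀ {xs} (f : A → ℕ) {x} → x ∈ xs → f x ≤ ∑ xs f
  ∈⇒≤∑ f {x} (here refl) = m≤m+n (f x) _
  ∈⇒≤∑ {y ∷ _} f (there x∈) = ≤-trans (∈⇒≤∑ f x∈) (m≤n+m _ (f y))

∑-comm : {A B : Set} (xs : List A) (ys : List B) (f : A → B → ℕ) →
         ∑[ x ∈ xs ] (∑[ y ∈ ys ] f x y) ≡ ∑[ y ∈ ys ] (∑[ x ∈ xs ] f x y)
∑-comm []       ys f = sym (∑-zero ys (λ _ → refl))
∑-comm (x ∷ xs) ys f = trans (cong (∑ ys (f x) +_) (∑-comm xs ys f))
                             (sym (∑-distrib-+ ys (f x) (λ y → ∑[ x′ ∈ xs ] f x′ y)))

∑-upTo-suc : ∀ N (f : ℕ → ℕ) → ∑ (upTo (suc N)) f ≡ ∑ (upTo N) f + f N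
∑-upTo-suc N f = begin
  ∑ (upTo (suc N)) f               ≡⟨ cong (λ xs → ∑ xs f) (upTo-∷ʳ N) ⟨
  sum (map f (upTo N ++ [ N ]))    ≡⟨ cong sum (map-++ f (upTo N) [ N ]) ⟩
  sum (map f (upTo N) ++ [ f N ])  ≡⟨ sum-++ (map f (upTo N)) [ f N ] ⟩
  ∑ (upTo N) f + (f N + 0)         ≡⟨ cong (∑ (upTo N) f +_) (+-identityʳ (f N)) ⟩
  ∑ (upTo N) f + f N               ∎
  where open ≡-Reasoning

∑-allFin-suc : ∀ {k} (f : Fin (suc k) → ℕ) → ∑ (allFin (suc k)) f ≡ f zero + ∑[ i ∈ allFin k ] f (suc i)
∑-allFin-suc f = cong (λ xs → f zero + sum xs)
  (trans (map-tabulate suc f) (sym (map-tabulate id (λ i → f (suc i)))))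

∑-allFin-single : ∀ {k} (f : Fin k → ℕ) a → (∀ i → i ≢ a → f i ≡ 0) → ∑ (allFin k) f ≡ f a
∑-allFin-single {suc k} f zero    off = begin
  ∑ (allFin (suc k)) f                  ≡⟨ ∑-allFin-suc f ⟩
  f zero + ∑[ i ∈ allFin k ] f (suc i)  ≡⟨ cong (f zero +_) (∑-zero (allFin k) (λ i → off (suc i) (λ ()))) ⟩
  f zero + 0                            ≡⟨ +-identityʳ (f zero) ⟩
  f zero                                ∎
  where open ≡-Reasoning
∑-allFin-single {suc k} f (suc a) off = trans (∑-allFin-suc f) (cong₂ _+_ (off zero (λ ()))
  (∑-allFin-single (λ i → f (suc i)) a (λ i i≢a → off (suc i) (i≢a ∘ suc-injective))))

∑-allFin-update : ∀ {k} (f g : Fin k → ℕ) a → (∀ i → i ≢ a → f i ≡ g i) →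
                  ∑ (allFin k) f + g a ≡ ∑ (allFin k) g + f a
∑-allFin-update {suc k} f g zero eq = begin
  ∑ (allFin (suc k)) f + g zero             ≡⟨ cong (_+ g zero) (∑-allFin-suc f) ⟩
  f zero + ∑[ i ∈ allFin k ] f (suc i) + g zero
    ≡⟨ cong (λ r → f zero + r + g zero) (∑-cong (allFin k) (λ i → eq (suc i) (λ ()))) ⟩
  f zero + ∑[ i ∈ allFin k ] g (suc i) + g zero  ≡⟨ xy∙z≈zy∙x (f zero) _ (g zero) ⟩
  g zero + ∑[ i ∈ allFin k ] g (suc i) + f zero  ≡⟨ cong (_+ f zero) (∑-allFin-suc g) ⟨
  ∑ (allFin (suc k)) g + f zero             ∎
  where open ≡-Reasoning
∑-allFin-update {suc k} f g (suc a) eq = begin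
  ∑ (allFin (suc k)) f + g (suc a)                       ≡⟨ cong (_+ g (suc a)) (∑-allFin-suc f) ⟩
  f zero + ∑[ i ∈ allFin k ] f (suc i) + g (suc a)       ≡⟨ +-assoc (f zero) _ _ ⟩
  f zero + (∑[ i ∈ allFin k ] f (suc i) + g (suc a))
    ≡⟨ cong₂ _+_ (eq zero (λ ())) (∑-allFin-update (λ i → f (suc i)) (λ i → g (suc i)) a
                                     (λ i i≢a → eq (suc i) (i≢a ∘ suc-injective))) ⟩
  g zero + (∑[ i ∈ allFin k ] g (suc i) + f (suc a))     ≡⟨ +-assoc (g zero) _ _ ⟨
  g zero + ∑[ i ∈ allFin k ] g (suc i) + f (suc a)       ≡⟨ cong (_+ f (suc a)) (∑-allFin-suc g) ⟨
  ∑ (allFin (suc k)) g + f (suc a)                       ∎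
  where open ≡-Reasoning

∑-allFin-≤1 : ∀ {k} (f : Fin k → ℕ) → (∀ i → f i ≤ 1) → (∀ i j → 0 < f i → 0 < f j → i ≡ j) →
              ∑ (allFin k) f ≤ 1
∑-allFin-≤1 {zero}  f f≤1 unique = z≤n
∑-allFin-≤1 {suc k} f f≤1 unique with f zero ℕ.≟ 0
... | yes f0≡0 = begin
  ∑ (allFin (suc k)) f                  ≡⟨ ∑-allFin-suc f ⟩
  f zero + ∑[ i ∈ allFin k ] f (suc i)  ≡⟨ cong (_+ ∑[ i ∈ allFin k ] f (suc i)) f0≡0 ⟩
  ∑[ i ∈ allFin k ] f (suc i)
    ≤⟨ ∑-allFin-≤1 (λ i → f (suc i)) (λ i → f≤1 (suc i))
                   (λ i j fi>0 fj>0 → suc-injective (unique (suc i) (suc j) fi>0 fj>0)) ⟩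
  1                                     ∎
  where open ≤-Reasoning
... | no f0≢0 = begin
  ∑ (allFin (suc k)) f                  ≡⟨ ∑-allFin-suc f ⟩
  f zero + ∑[ i ∈ allFin k ] f (suc i)  ≡⟨ cong (f zero +_) (∑-zero (allFin k) tail≡0) ⟩
  f zero + 0                            ≡⟨ +-identityʳ (f zero) ⟩
  f zero                                ≤⟨ f≤1 zero ⟩
  1                                     ∎
  where
  open ≤-Reasoning
  tail≡0 : ∀ i → f (suc i) ≡ 0
  tail≡0 i with f (suc i) ℕ.≟ 0
  ... | yes fi≡0 = fi≡0
  ... | no fi≢0 with () ← unique zero (suc i) (n≢0⇒n>0 f0≢0) (n≢0⇒n>0 fi≢0)

infix 4 _∈?_
_∈?_ : ∀ {k} (i : Fin k) (is : List (Fin k)) → Dec (i ∈ is)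
i ∈? is = Any.any? (i ≟_) is

module _ {A : Set} (_≟ᴬ_ : DecidableEquality A) where

  ∑-pick-∉ : ∀ {x xs} (g : A → ℕ) → x ∉ xs → ∑[ y ∈ xs ] (𝟙 (x ≟ᴬ y) * g y) ≡ 0
  ∑-pick-∉ {x} {xs} g x∉ = ∑-zero-∈ xs (λ y y∈ → cong (_* g y) (𝟙-no (x ≟ᴬ y) (λ { refl → x∉ y∈ })))

  ∑-pick : ∀ {x xs} (g : A → ℕ) → Unique xs → x ∈ xs → ∑[ y ∈ xs ] (𝟙 (x ≟ᴬ y) * g y) ≡ g x
  ∑-pick {x} {y ∷ ys} g (y∉ys ∷ _) (here refl) = begin
    𝟙 (x ≟ᴬ x) * g x + ∑[ z ∈ ys ] (𝟙 (x ≟ᴬ z) * g z)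
      ≡⟨ cong₂ _+_ (cong (_* g x) (𝟙-yes (x ≟ᴬ x) refl)) (∑-pick-∉ g (All¬⇒¬Any y∉ys)) ⟩
    1 * g x + 0
      ≡⟨ trans (+-identityʳ _) (*-identityˡ (g x)) ⟩
    g x ∎
    where open ≡-Reasoning
  ∑-pick {x} {y ∷ ys} g (y∉ys ∷ uniq) (there x∈ys) = begin
    𝟙 (x ≟ᴬ y) * g y + ∑[ z ∈ ys ] (𝟙 (x ≟ᴬ z) * g z)
      ≡⟨ cong₂ _+_ (cong (_* g y) (𝟙-no (x ≟ᴬ y) (All.lookup y∉ys x∈ys ∘ sym))) (∑-pick g uniq x∈ys) ⟩
    g x ∎
    where open ≡-Reasoning

≤-∑-pick : ∀ {x N} (g : ℕ → ℕ) → (0 < g x → x < N) → g x ≤ ∑[ θ ∈ upTo N ] (𝟙 (x ℕ.≟ θ) * g θ)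
≤-∑-pick {x} {N} g inside with g x ℕ.≟ 0
... | yes gx≡0 = subst (_≤ ∑[ θ ∈ upTo N ] (𝟙 (x ℕ.≟ θ) * g θ)) (sym gx≡0) z≤n
... | no  gx≢0 = ≤-reflexive (sym (∑-pick ℕ._≟_ g (upTo⁺ N) (∈-upTo⁺ (inside (n≢0⇒n>0 gx≢0)))))

InWindow : ℕ → ℕ → ℕ → Set
InWindow o k θ = o ≤ θ × θ < o + k

inWindow? : ∀ o k θ → Dec (InWindow o k θ)
inWindow? o k θ = o ≤? θ ×-dec θ <? o + k

window : ℕ → ℕ → ℕ → ℕ
window o k θ = 𝟙 (inWindow? o k θ)

window-zero : ∀ o θ → window o 0 θ ≡ 0
window-zero o θ = 𝟙-no (inWindow? o 0 θ) (λ (o≤θ , θ<o+0) → <⇒≱ θ<o+0 (≤-trans (≤-reflexive (+-identityʳ o)) o≤θ))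

window-suc : ∀ o k θ → window o (suc k) θ ≡ window o k θ + 𝟙 (o + k ℕ.≟ θ)
window-suc o k θ = by-cases (o + k ℕ.≟ θ)
  where
  by-cases : (o+k≟θ : Dec (o + k ≡ θ)) → window o (suc k) θ ≡ window o k θ + 𝟙 o+k≟θ
  by-cases (yes refl) = begin
    window o (suc k) (o + k)   ≡⟨ 𝟙-yes (inWindow? o (suc k) (o + k)) (m≤m+n o k , +-monoʳ-< o (n<1+n k)) ⟩
    1                          ≡⟨ cong (_+ 1) (𝟙-no (inWindow? o k (o + k)) (λ (_ , lt) → <-irrefl refl lt)) ⟨
    window o k (o + k) + 1     ∎
    where open ≡-Reasoning
  by-cases (no o+k≢θ) = trans (𝟙-cong shrink grow (inWindow? o (suc k) θ) (inWindow? o k θ)) (sym (+-identityʳ _))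
    where
    shrink : InWindow o (suc k) θ → InWindow o k θ
    shrink (o≤θ , θ<) = o≤θ , ≤∧≢⇒< (s≤s⁻¹ (subst (θ <_) (+-suc o k) θ<)) (o+k≢θ ∘ sym)
    grow : InWindow o k θ → InWindow o (suc k) θ
    grow (o≤θ , θ<) = o≤θ , <-≤-trans θ< (+-monoʳ-≤ o (n≤1+n k))

∑-offsets : ∀ o k θ → ∑[ j ∈ upTo k ] 𝟙 (o + j ℕ.≟ θ) ≡ window o k θ
∑-offsets o zero    θ = sym (window-zero o θ)
∑-offsets o (suc k) θ = begin
  ∑[ j ∈ upTo (suc k) ] 𝟙 (o + j ℕ.≟ θ)               ≡⟨ ∑-upTo-suc k (λ j → 𝟙 (o + j ℕ.≟ θ)) ⟩
  ∑[ j ∈ upTo k ] 𝟙 (o + j ℕ.≟ θ) + 𝟙 (o + k ℕ.≟ θ)   ≡⟨ cong (_+ 𝟙 (o + k ℕ.≟ θ)) (∑-offsets o k θ) ⟩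
  window o k θ + 𝟙 (o + k ℕ.≟ θ)                      ≡⟨ window-suc o k θ ⟨
  window o (suc k) θ                                  ∎
  where open ≡-Reasoning

∑-window : ∀ {o k N} → o + k ≤ N → ∑[ θ ∈ upTo N ] window o k θ ≡ k
∑-window {o} {k} {N} o+k≤N = begin
  ∑[ θ ∈ upTo N ] window o k θ                                 ≡⟨ ∑-cong (upTo N) (λ θ → sym (∑-offsets o k θ)) ⟩
  ∑[ θ ∈ upTo N ] (∑[ j ∈ upTo k ] 𝟙 (o + j ℕ.≟ θ))            ≡⟨ ∑-comm (upTo N) (upTo k) _ ⟩
  ∑[ j ∈ upTo k ] (∑[ θ ∈ upTo N ] 𝟙 (o + j ℕ.≟ θ))
    ≡⟨ ∑-cong-∈ (upTo k) (λ j j∈ → picked j (∈-upTo⁻ j∈)) ⟩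
  ∑ (upTo k) (λ _ → 1)                                         ≡⟨ ∑-const (upTo k) 1 ⟩
  length (upTo k) * 1                                          ≡⟨ trans (*-identityʳ _) (length-upTo k) ⟩
  k                                                            ∎
  where
  open ≡-Reasoning
  picked : ∀ j → j < k → ∑[ θ ∈ upTo N ] 𝟙 (o + j ℕ.≟ θ) ≡ 1
  picked j j<k = trans (∑-cong (upTo N) (λ θ → sym (*-identityʳ _)))
                       (∑-pick ℕ._≟_ (λ _ → 1) (upTo⁺ N) (∈-upTo⁺ (<-≤-trans (+-monoʳ-< o j<k) o+k≤N)))

window-shift : ∀ τ o k θ → 𝟙 (τ ≤? θ) * window o k (θ ∸ τ) ≡ window (o + τ) k θ
window-shift τ o k θ = by-cases (τ ≤? θ)
  where
  by-cases : (τ≤?θ : Dec (τ ≤ θ)) → 𝟙 τ≤?θ * window o k (θ ∸ τ) ≡ window (o + τ) k θ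
  by-cases (no τ≰θ)  = sym (𝟙-no (inWindow? (o + τ) k θ) (λ (o+τ≤θ , _) → τ≰θ (≤-trans (m≤n+m τ o) o+τ≤θ)))
  by-cases (yes τ≤θ) = trans (+-identityʳ _) (𝟙-cong shift unshift (inWindow? o k (θ ∸ τ)) (inWindow? (o + τ) k θ))
    where
    shift : InWindow o k (θ ∸ τ) → InWindow (o + τ) k θ
    shift (o≤ , <o+k) = m≤o∸n⇒m+n≤o o τ≤θ o≤ ,
      (begin-strict
        θ                ≡⟨ m∸n+n≡m τ≤θ ⟨
        θ ∸ τ + τ        <⟨ +-monoˡ-< τ <o+k ⟩
        o + k + τ        ≡⟨ xy∙z≈xz∙y o k τ ⟩
        o + τ + k        ∎)
      where open ≤-Reasoning
    unshift : InWindow (o + τ) k θ → InWindow o k (θ ∸ τ)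
    unshift (o+τ≤ , <o+τ+k) = m+n≤o⇒m≤o∸n o o+τ≤ ,
      (begin-strict
        θ ∸ τ            <⟨ ∸-monoˡ-< <o+τ+k τ≤θ ⟩
        o + τ + k ∸ τ    ≡⟨ cong (_∸ τ) (xy∙z≈xz∙y o τ k) ⟩
        o + k + τ ∸ τ    ≡⟨ m+n∸n≡m (o + k) τ ⟩
        o + k            ∎)
      where open ≤-Reasoning

private
  ∸-<-window : ∀ {a b θ Δ} → a ≤ θ → b ≤ θ → θ < b + Δ → a ∸ b < Δ
  ∸-<-window {a} {b} {θ} {Δ} a≤θ b≤θ θ<b+Δ =
    ≤-<-trans (∸-monoˡ-≤ b a≤θ) (subst (θ ∸ b <_) (m+n∸m≡n b Δ) (∸-monoˡ-< θ<b+Δ b≤θ))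

windows-close : ∀ {e₁ e₂ Δ θ} → InWindow e₁ Δ θ → InWindow e₂ Δ θ → ∣ e₁ - e₂ ∣ < Δ
windows-close {e₁} {e₂} {Δ} (e₁≤θ , θ<e₁+Δ) (e₂≤θ , θ<e₂+Δ) with ∣m-n∣≡[m∸n]∨[n∸m] e₁ e₂
... | inj₁ eq = subst (_< Δ) (sym eq) (∸-<-window e₁≤θ e₂≤θ θ<e₂+Δ)
... | inj₂ eq = subst (_< Δ) (sym eq) (∸-<-window e₂≤θ e₁≤θ θ<e₁+Δ)

∈⇒≤max : ∀ {A : Set} (g : A → ℕ) {x xs} → x ∈ xs → g x ≤ foldr _⊔_ 0 (map g xs)
∈⇒≤max g {x} (here refl)  = m≤m⊔n (g x) _
∈⇒≤max g {xs = y ∷ _} (there x∈) = ≤-trans (∈⇒≤max g x∈) (m≤n⊔m (g y) _)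

module _ (D : Network) where
  open Network D

  δ : Fin n → Fin n → ℕ
  δ u v = 𝟙 (u ≟ v)

  δ-refl : ∀ u → δ u u ≡ 1
  δ-refl u = 𝟙-yes (u ≟ u) refl

  δ-≢ : ∀ {u v} → u ≢ v → δ u v ≡ 0
  δ-≢ {u} {v} = 𝟙-no (u ≟ v)

  *δ-≢ : ∀ c {u v} → u ≢ v → c * δ u v ≡ 0
  *δ-≢ c u≢v = trans (cong (c *_) (δ-≢ u≢v)) (*-zeroʳ c)

  *δ-refl : ∀ c u → c * δ u u ≡ c
  *δ-refl c u = trans (cong (c *_) (δ-refl u)) (*-identityʳ c)

  ∑-δ : ∀ u (c : Fin n → ℕ) → ∑[ v ∈ allFin n ] (δ u v * c v) ≡ c u
  ∑-δ u c = trans (∑-allFin-single (λ v → δ u v * c v) u (λ v v≢u → cong (_* c v) (δ-≢ (v≢u ∘ sym))))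
                  (trans (cong (_* c u) (δ-refl u)) (+-identityʳ (c u)))

  incident : (Fin m → Fin n) → (Fin m → ℕ) → Fin n → ℕ
  incident h g v = ∑[ a ∈ allFin m ] (g a * δ (h a) v)

  incident-+ : ∀ h (g g′ : Fin m → ℕ) v → incident h (λ a → g a + g′ a) v ≡ incident h g v + incident h g′ v
  incident-+ h g g′ v = trans (∑-cong (allFin m) (λ a → *-distribʳ-+ (δ (h a) v) (g a) (g′ a)))
                              (∑-distrib-+ (allFin m) _ _)

  incident-zero : ∀ h {g : Fin m → ℕ} v → (∀ a → g a ≡ 0) → incident h g v ≡ 0
  incident-zero h v g≡0 = ∑-zero (allFin m) (λ a → cong (_* δ (h a) v) (g≡0 a))

  incident-single : ∀ h (g : Fin m → ℕ) b v → (∀ a → a ≢ b → g a ≡ 0) → incident h g v ≡ g b * δ (h b) v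
  incident-single h g b v off = ∑-allFin-single _ b (λ a a≢b → cong (_* δ (h a) v) (off a a≢b))

  incident-≤ : ∀ h (g : Fin m → ℕ) v → (∀ a → g a ≤ 1) → incident h g v ≤ m
  incident-≤ h g v g≤1 = begin
    incident h g v             ≤⟨ ∑-mono (allFin m) (λ a → *-mono-≤ (g≤1 a) (𝟙≤1 (h a ≟ v))) ⟩
    ∑ (allFin m) (λ _ → 1)     ≡⟨ ∑-const (allFin m) 1 ⟩
    length (allFin m) * 1      ≡⟨ trans (*-identityʳ _) (length-tabulate id) ⟩
    m                          ∎
    where open ≤-Reasoning

  ∑-incident : ∀ h (g : Fin m → ℕ) (w : Fin n → ℕ) →
               ∑[ v ∈ allFin n ] (w v * incident h g v) ≡ ∑[ a ∈ allFin m ] (g a * w (h a))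
  ∑-incident h g w = begin
    ∑[ v ∈ allFin n ] (w v * incident h g v)
      ≡⟨ ∑-cong (allFin n) (λ v → ∑-distribˡ (allFin m) (w v) _) ⟩
    ∑[ v ∈ allFin n ] (∑[ a ∈ allFin m ] (w v * (g a * δ (h a) v)))
      ≡⟨ ∑-comm (allFin n) (allFin m) _ ⟩
    ∑[ a ∈ allFin m ] (∑[ v ∈ allFin n ] (w v * (g a * δ (h a) v)))
      ≡⟨ ∑-cong (allFin m) (λ a → ∑-cong (allFin n) (λ v → rearrange (w v) (g a) (δ (h a) v))) ⟩
    ∑[ a ∈ allFin m ] (∑[ v ∈ allFin n ] (g a * (δ (h a) v * w v)))
      ≡⟨ ∑-cong (allFin m) (λ a → sym (∑-distribˡ (allFin n) (g a) _)) ⟩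
    ∑[ a ∈ allFin m ] (g a * ∑[ v ∈ allFin n ] (δ (h a) v * w v))
      ≡⟨ ∑-cong (allFin m) (λ a → cong (g a *_) (∑-δ (h a) w)) ⟩
    ∑[ a ∈ allFin m ] (g a * w (h a))  ∎
    where
    open ≡-Reasoning
    rearrange : ∀ x y z → x * (y * z) ≡ y * (z * x)
    rearrange x y z = trans (*-comm x (y * z)) (*-assoc y z x)

  toggle : Fin m → (Fin m → Bool) → Fin m → Bool
  toggle a x b with b ≟ a
  ... | yes _ = not (x b)
  ... | no  _ = x b

  toggle-≡ : ∀ a x → toggle a x a ≡ not (x a)
  toggle-≡ a x with a ≟ a
  ... | yes _   = refl
  ... | no  a≢a = ⊥-elim (a≢a refl)

  toggle-≢ : ∀ {a b} x → b ≢ a → toggle a x b ≡ x b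
  toggle-≢ {a} {b} x b≢a with b ≟ a
  ... | yes b≡a = ⊥-elim (b≢a b≡a)
  ... | no  _   = refl

  toggleAll : List (Fin m) → (Fin m → Bool) → Fin m → Bool
  toggleAll []      x = x
  toggleAll (a ∷ Q) x = toggleAll Q (toggle a x)

  toggleAll-∉ : ∀ Q x {a} → a ∉ Q → toggleAll Q x a ≡ x a
  toggleAll-∉ []      x a∉ = refl
  toggleAll-∉ (b ∷ Q) x a∉ = trans (toggleAll-∉ Q (toggle b x) (a∉ ∘ there)) (toggle-≢ x (a∉ ∘ here))

  toggleAll-∈ : ∀ {Q} x {a} → Unique Q → a ∈ Q → toggleAll Q x a ≡ not (x a)
  toggleAll-∈ {a ∷ Q} x (a∉Q ∷ _) (here refl) = trans (toggleAll-∉ Q (toggle a x) (All¬⇒¬Any a∉Q)) (toggle-≡ a x)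
  toggleAll-∈ {b ∷ Q} x (b∉Q ∷ uniq) (there a∈Q) =
    trans (toggleAll-∈ (toggle b x) uniq a∈Q) (cong not (toggle-≢ x (All.lookup b∉Q a∈Q ∘ sym)))

  weight : (Fin m → Bool) → (Fin m → ℕ) → ℕ
  weight x c = ∑[ a ∈ allFin m ] (bit (x a) * c a)

  private
    weight-update : ∀ x a c → weight x c + bit (toggle a x a) * c a ≡ weight (toggle a x) c + bit (x a) * c a
    weight-update x a c = ∑-allFin-update _ _ a (λ b b≢a → cong (λ z → bit z * c b) (sym (toggle-≢ x b≢a)))

  weight-toggle : ∀ {x a} c → x a ≡ false → weight (toggle a x) c ≡ weight x c + c a
  weight-toggle {x} {a} c xa≡false = begin
    weight (toggle a x) c                      ≡⟨ +-identityʳ _ ⟨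
    weight (toggle a x) c + 0                  ≡⟨ cong (λ z → weight (toggle a x) c + bit z * c a) xa≡false ⟨
    weight (toggle a x) c + bit (x a) * c a    ≡⟨ weight-update x a c ⟨
    weight x c + bit (toggle a x a) * c a      ≡⟨ cong (λ z → weight x c + bit z * c a) (trans (toggle-≡ a x) (cong not xa≡false)) ⟩
    weight x c + (c a + 0)                     ≡⟨ cong (weight x c +_) (+-identityʳ (c a)) ⟩
    weight x c + c a                           ∎
    where open ≡-Reasoning

  weight-toggle⁻ : ∀ {x a} c → x a ≡ true → weight x c ≡ weight (toggle a x) c + c a
  weight-toggle⁻ {x} {a} c xa≡true = begin
    weight x c                                 ≡⟨ +-identityʳ _ ⟨
    weight x c + 0                             ≡⟨ cong (λ z → weight x c + bit z * c a) (trans (toggle-≡ a x) (cong not xa≡true)) ⟨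
    weight x c + bit (toggle a x a) * c a      ≡⟨ weight-update x a c ⟩
    weight (toggle a x) c + bit (x a) * c a    ≡⟨ cong (λ z → weight (toggle a x) c + bit z * c a) xa≡true ⟩
    weight (toggle a x) c + (c a + 0)          ≡⟨ cong (weight (toggle a x) c +_) (+-identityʳ (c a)) ⟩
    weight (toggle a x) c + c a                ∎
    where open ≡-Reasoning

  inCount outCount : (Fin m → Bool) → Fin n → ℕ
  inCount  x v = weight x (λ a → δ (tgt a) v)
  outCount x v = weight x (λ a → δ (src a) v)

  private
    balance-trans : ∀ i₀ o₀ i₁ o₁ i₂ o₂ p q r → i₁ + o₀ + p ≡ o₁ + i₀ + q → i₂ + o₁ + q ≡ o₂ + i₁ + r →
                    i₂ + o₀ + p ≡ o₂ + i₀ + r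
    balance-trans i₀ o₀ i₁ o₁ i₂ o₂ p q r e₁ e₂ = +-cancelʳ-≡ (i₁ + o₁ + q) _ _ (begin
      i₂ + o₀ + p + (i₁ + o₁ + q)    ≡⟨ regroup₁ i₀ o₀ i₁ o₁ i₂ o₂ p q r ⟩
      i₁ + o₀ + p + (i₂ + o₁ + q)    ≡⟨ cong₂ _+_ e₁ e₂ ⟩
      o₁ + i₀ + q + (o₂ + i₁ + r)    ≡⟨ regroup₂ i₀ o₀ i₁ o₁ i₂ o₂ p q r ⟩
      o₂ + i₀ + r + (i₁ + o₁ + q)    ∎)
      where
      open ≡-Reasoning
      regroup₁ : ∀ i₀ o₀ i₁ o₁ i₂ o₂ p q r → i₂ + o₀ + p + (i₁ + o₁ + q) ≡ i₁ + o₀ + p + (i₂ + o₁ + q)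
      regroup₁ = solve-∀
      regroup₂ : ∀ i₀ o₀ i₁ o₁ i₂ o₂ p q r → o₁ + i₀ + q + (o₂ + i₁ + r) ≡ o₂ + i₀ + r + (i₁ + o₁ + q)
      regroup₂ = solve-∀

  -- y − x is one unit of flow from u to w; stated with both sides moved so that no subtraction occurs.
  record Shifted (x y : Fin m → Bool) (u w : Fin n) : Set where
    constructor shifted
    field balance : ∀ v → inCount y v + outCount x v + δ u v ≡ outCount y v + inCount x v + δ w v
  open Shifted public

  shifted-refl : ∀ {x u} → Shifted x x u u
  shifted-refl {x} {u} = shifted λ v → cong (_+ δ u v) (+-comm (inCount x v) (outCount x v))

  shifted-trans : ∀ {x y z u w w′} → Shifted x y u w → Shifted y z w w′ → Shifted x z u w′
  shifted-trans {x} {y} {z} {u} {w} {w′} x→y y→z = shifted λ v →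
    balance-trans (inCount x v) (outCount x v) (inCount y v) (outCount y v) (inCount z v) (outCount z v)
                  (δ u v) (δ w v) (δ w′ v) (balance x→y v) (balance y→z v)

  shifted-trans˘ : ∀ {x y z u w w′} → Shifted y z u w → Shifted x y w w′ → Shifted x z u w′
  shifted-trans˘ {x} {y} {z} {u} {w} {w′} y→z x→y = shifted λ v → sym
    (balance-trans (outCount x v) (inCount x v) (outCount y v) (inCount y v) (outCount z v) (inCount z v)
                   (δ w′ v) (δ w v) (δ u v) (sym (balance x→y v)) (sym (balance y→z v)))

  toggle-shifted : ∀ {x a} → x a ≡ false → Shifted x (toggle a x) (src a) (tgt a)
  toggle-shifted {x} {a} xa≡false = shifted λ v → begin
    inCount (toggle a x) v + outCount x v + δ (src a) v
      ≡⟨ cong (λ i → i + outCount x v + δ (src a) v) (weight-toggle (λ b → δ (tgt b) v) xa≡false) ⟩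
    inCount x v + δ (tgt a) v + outCount x v + δ (src a) v
      ≡⟨ regroup (inCount x v) (outCount x v) (δ (tgt a) v) (δ (src a) v) ⟩
    outCount x v + δ (src a) v + inCount x v + δ (tgt a) v
      ≡⟨ cong (λ o → o + inCount x v + δ (tgt a) v) (weight-toggle (λ b → δ (src b) v) xa≡false) ⟨
    outCount (toggle a x) v + inCount x v + δ (tgt a) v  ∎
    where
    open ≡-Reasoning
    regroup : ∀ i o dₜ dₛ → i + dₜ + o + dₛ ≡ o + dₛ + i + dₜ
    regroup = solve-∀

  toggle-shifted⁻ : ∀ {x a} → x a ≡ true → Shifted x (toggle a x) (tgt a) (src a)
  toggle-shifted⁻ {x} {a} xa≡true = shifted λ v → begin
    inCount (toggle a x) v + outCount x v + δ (tgt a) v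
      ≡⟨ cong (λ o → inCount (toggle a x) v + o + δ (tgt a) v) (weight-toggle⁻ (λ b → δ (src b) v) xa≡true) ⟩
    inCount (toggle a x) v + (outCount (toggle a x) v + δ (src a) v) + δ (tgt a) v
      ≡⟨ regroup (inCount (toggle a x) v) (outCount (toggle a x) v) (δ (tgt a) v) (δ (src a) v) ⟩
    outCount (toggle a x) v + (inCount (toggle a x) v + δ (tgt a) v) + δ (src a) v
      ≡⟨ cong (λ i → outCount (toggle a x) v + i + δ (src a) v) (weight-toggle⁻ (λ b → δ (tgt b) v) xa≡true) ⟨
    outCount (toggle a x) v + inCount x v + δ (src a) v  ∎
    where
    open ≡-Reasoning
    regroup : ∀ i o dₜ dₛ → i + (o + dₛ) + dₜ ≡ o + (i + dₜ) + dₛ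
    regroup = solve-∀

  -- Residual graphs and path search

  data Edge : Set where
    fwd bwd : Fin m → Edge

  arc : Edge → Fin m
  arc (fwd a) = a
  arc (bwd a) = a

  start end : Edge → Fin n
  start (fwd a) = src a
  start (bwd a) = tgt a
  end (fwd a) = tgt a
  end (bwd a) = src a

  start-endpoint : ∀ {e e′} → arc e ≡ arc e′ → start e ≡ start e′ ⊎ start e ≡ end e′
  start-endpoint {fwd a} {fwd _} refl = inj₁ refl
  start-endpoint {fwd a} {bwd _} refl = inj₂ refl
  start-endpoint {bwd a} {fwd _} refl = inj₂ refl
  start-endpoint {bwd a} {bwd _} refl = inj₁ refl

  arcs : List Edge → List (Fin m)
  arcs = map arc

  Walk : Fin n → List Edge → Fin n → Set
  Walk u []      w = u ≡ w
  Walk u (e ∷ P) w = start e ≡ u × Walk (end e) P w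

  Residual : (Fin m → Bool) → Edge → Set
  Residual x (fwd a) = x a ≡ false
  Residual x (bwd a) = x a ≡ true

  residual-toggle-≢ : ∀ {x a} e → a ≢ arc e → Residual x e → Residual (toggle a x) e
  residual-toggle-≢ {x} (fwd b) a≢b r = trans (toggle-≢ x (a≢b ∘ sym)) r
  residual-toggle-≢ {x} (bwd b) a≢b r = trans (toggle-≢ x (a≢b ∘ sym)) r

  residual-shifted : ∀ {x} e → Residual x e → Shifted x (toggle (arc e) x) (start e) (end e)
  residual-shifted (fwd a) = toggle-shifted
  residual-shifted (bwd a) = toggle-shifted⁻

  augment-shifted : ∀ {u P w} x → Walk u P w → All (Residual x) P → Unique (arcs P) →
                    Shifted x (toggleAll (arcs P) x) u w
  augment-shifted {P = []}    x refl       []       []            = shifted-refl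
  augment-shifted {P = e ∷ P} x (refl , W) (r ∷ rs) (e∉P ∷ uniq) =
    shifted-trans (residual-shifted e r) (augment-shifted (toggle (arc e) x) W rs′ uniq)
    where
    rs′ : All (Residual (toggle (arc e) x)) P
    rs′ = All.zipWith (λ (ne , r) → residual-toggle-≢ _ ne r) (map⁻ e∉P , rs)

  toggle-preserves-true : ∀ {x b Q} → All (b ≢_) Q → All (λ a → x a ≡ true) Q → All (λ a → toggle b x a ≡ true) Q
  toggle-preserves-true {x} b∉Q xQ = All.zipWith (λ (b≢a , xa) → trans (toggle-≢ x (b≢a ∘ sym)) xa) (b∉Q , xQ)

  weight-toggleAll⁻ : ∀ {x Q} c → All (λ a → x a ≡ true) Q → Unique Q → weight x c ≡ weight (toggleAll Q x) c + ∑ Q c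
  weight-toggleAll⁻ {x} {[]}    c []        []           = sym (+-identityʳ _)
  weight-toggleAll⁻ {x} {b ∷ Q} c (xb ∷ xQ) (b∉Q ∷ uniq) = begin
    weight x c                                                  ≡⟨ weight-toggle⁻ c xb ⟩
    weight (toggle b x) c + c b                                 ≡⟨ cong (_+ c b) (weight-toggleAll⁻ c (toggle-preserves-true b∉Q xQ) uniq) ⟩
    weight (toggleAll Q (toggle b x)) c + ∑ Q c + c b           ≡⟨ xy∙z≈x∙zy _ (∑ Q c) (c b) ⟩
    weight (toggleAll Q (toggle b x)) c + (c b + ∑ Q c)         ∎
    where open ≡-Reasoning

  remove-shifted : ∀ {u Q w} x → Connects D u Q w → All (λ a → x a ≡ true) Q → Unique Q →
                   Shifted x (toggleAll Q x) w u
  remove-shifted {Q = []}    x refl       []         []            = shifted-refl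
  remove-shifted {Q = b ∷ Q} x (refl , C) (xb ∷ xQ) (b∉Q ∷ uniq) =
    shifted-trans˘ (remove-shifted (toggle b x) C (toggle-preserves-true b∉Q xQ) uniq) (toggle-shifted⁻ xb)

  any-edge? : ∀ {P : Edge → Set} → Decidable P → Dec (∃ P)
  any-edge? P? with any? (P? ∘ fwd) | any? (P? ∘ bwd)
  ... | yes (a , p) | _           = yes (fwd a , p)
  ... | no _        | yes (a , p) = yes (bwd a , p)
  ... | no ¬fwd     | no ¬bwd     = no λ { (fwd a , p) → ¬fwd (a , p) ; (bwd a , p) → ¬bwd (a , p) }

  Closed : (Edge → Set) → (Fin n → Bool) → Set
  Closed U R = ∀ e → U e → R (start e) ≡ true → R (end e) ≡ true

  -- A backward search from t: rest holds the vertices not yet known to reach t, and every other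
  -- vertex has a usable path to t with distinct arcs, none of which touches rest.
  module Search {U : Edge → Set} (U? : Decidable U) (s t : Fin n) where

    data Outcome : Set where
      path : (P : List Edge) → Walk s P t → All U P → Unique (arcs P) → Outcome
      cut  : (R : Fin n → Bool) → R s ≡ true → R t ≡ false → Closed U R → Outcome

    private
      without : Fin n → List (Fin n) → List (Fin n)
      without v = filter (λ u → ¬? (u ≟ v))

      ∈-without⁻ : ∀ {u v rest} → u ∈ without v rest → u ∈ rest × u ≢ v
      ∈-without⁻ {v = v} {rest} = ∈-filter⁻ (λ u → ¬? (u ≟ v)) {xs = rest}

      ∈-without⁺ : ∀ {u v rest} → u ∈ rest → u ≢ v → u ∈ without v rest
      ∈-without⁺ {v = v} = ∈-filter⁺ (λ u → ¬? (u ≟ v))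

      record Outside (rest : List (Fin n)) (e : Edge) : Set where
        constructor outside
        field
          start∉ : start e ∉ rest
          end∉   : end e ∉ rest

      outside-without : ∀ rest u {e} → Outside rest e → Outside (without u rest) e
      outside-without rest u (outside st∉ en∉) =
        outside (st∉ ∘ proj₁ ∘ ∈-without⁻ {rest = rest}) (en∉ ∘ proj₁ ∘ ∈-without⁻ {rest = rest})

      PathToSink : List (Fin n) → Fin n → Set
      PathToSink rest v = Σ (List Edge) λ P → Walk v P t × All U P × Unique (arcs P) × All (Outside rest) P

      Frontier : List (Fin n) → Edge → Set
      Frontier rest e = U e × start e ∈ rest × end e ∉ rest

      frontier? : ∀ rest → Decidable (Frontier rest)
      frontier? rest e = U? e ×-dec start e ∈? rest ×-dec ¬? (end e ∈? rest)

      shrink : ∀ {rest} v → v ∈ rest → length (without v rest) < length rest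
      shrink {rest} v v∈ = filter-notAll (λ u → ¬? (u ≟ v)) rest (Any.map (λ v≡u ¬u≢v → ¬u≢v (sym v≡u)) v∈)

      weaken : ∀ rest u {v} → PathToSink rest v → PathToSink (without u rest) v
      weaken rest u (P , W , us , uniq , out) = P , W , us , uniq , All.map (outside-without rest u) out

      extend : ∀ {rest e} → Frontier rest e → PathToSink rest (end e) → PathToSink (without (start e) rest) (start e)
      extend {rest} {e} (u , st∈ , en∉) (P , W , us , uniq , out) =
        e ∷ P , (refl , W) , u ∷ us , map⁺ (All.map arc-e≢ out) ∷ uniq ,
        out-e ∷ All.map (outside-without rest (start e)) out
        where
        arc-e≢ : ∀ {e′} → Outside rest e′ → arc e ≢ arc e′
        arc-e≢ {e′} (outside st′∉ en′∉) eq with start-endpoint {e} {e′} eq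
        ... | inj₁ st≡st′ = st′∉ (subst (_∈ rest) st≡st′ st∈)
        ... | inj₂ st≡en′ = en′∉ (subst (_∈ rest) st≡en′ st∈)
        out-e : Outside (without (start e) rest) e
        out-e = outside (λ st∈′ → proj₂ (∈-without⁻ {rest = rest} st∈′) refl) (en∉ ∘ proj₁ ∘ ∈-without⁻ {rest = rest})

      loop : (fuel : ℕ) (rest : List (Fin n)) → length rest ≤ fuel → t ∉ rest →
             (∀ v → v ∉ rest → PathToSink rest v) → Outcome
      loop fuel rest len t∉ paths with s ∈? rest
      ... | no s∉ with paths s s∉
      ...   | P , W , us , uniq , _ = path P W us uniq
      loop fuel rest len t∉ paths | yes s∈ with any-edge? (frontier? rest)
      ... | no none = cut (λ v → does (v ∈? rest)) (dec-true (s ∈? rest) s∈) (dec-false (t ∈? rest) t∉) closed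
        where
        closed : Closed U (λ v → does (v ∈? rest))
        closed e u st = dec-true (end e ∈? rest)
          (decidable-stable (end e ∈? rest) (λ en∉ → none (e , u , does≡true⇒ (start e ∈? rest) st , en∉)))
      ... | yes (e , frontier@(_ , st∈ , _)) with fuel
      ...   | zero     = ⊥-elim (n≮0 (≤-trans (shrink (start e) st∈) len))
      ...   | suc fuel = loop fuel (without (start e) rest) (≤-pred (≤-trans (shrink (start e) st∈) len))
                              (t∉ ∘ proj₁ ∘ ∈-without⁻ {rest = rest}) paths′
        where
        paths′ : ∀ v → v ∉ without (start e) rest → PathToSink (without (start e) rest) v
        paths′ v v∉ with v ≟ start e
        ... | yes refl = extend {rest} {e} frontier (paths (end e) (proj₂ (proj₂ frontier)))
        ... | no v≢st  = weaken rest (start e) (paths v (λ v∈ → v∉ (∈-without⁺ v∈ v≢st)))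

    search : Outcome
    search = loop n (without t (allFin n)) (≤-trans (length-filter _ (allFin n)) (≤-reflexive (length-tabulate id)))
                  (λ t∈ → proj₂ (∈-without⁻ {rest = allFin n} t∈) refl) paths₀
      where
      paths₀ : ∀ v → v ∉ without t (allFin n) → PathToSink (without t (allFin n)) v
      paths₀ v v∉ with v ≟ t
      ... | yes refl = [] , refl , [] , [] , []
      ... | no v≢t   = ⊥-elim (v∉ (∈-without⁺ (∈-allFin v) v≢t))

  arrival : (Fin m → ℕ → ℕ) → Fin m → ℕ → ℕ
  arrival f a θ = 𝟙 (τ a ≤? θ) * f a (θ ∸ τ a)

  arriving departing : (Fin m → ℕ → ℕ) → Fin n → ℕ → ℕ
  arriving  f v θ = incident tgt (λ a → arrival f a θ) v
  departing f v θ = incident src (λ a → f a θ) v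

  -- The left-hand sides are the anonymous local helpers of inflow and outflow in Defs; the
  -- signatures leave them as metas, which the uses below solve before the clauses are checked.
  arriving-term : ∀ f v θ a → _ ≡ arrival f a θ * δ (tgt a) v
  departing-term : ∀ f v θ a → _ ≡ f a θ * δ (src a) v

  inflow≡arriving : ∀ f v θ → inflow D f v θ ≡ arriving f v θ
  inflow≡arriving f v θ = ∑-cong (allFin m) (arriving-term f v θ)

  outflow≡departing : ∀ f v θ → outflow D f v θ ≡ departing f v θ
  outflow≡departing f v θ = ∑-cong (allFin m) (departing-term f v θ)

  arriving-term f v θ a with tgt a ≟ v | τ a ≤? θ
  ... | yes _ | yes τ≤θ = sym (trans (cong (λ z → z * f a (θ ∸ τ a) * 1) (𝟙-yes (τ a ≤? θ) τ≤θ))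
                                     (trans (*-identityʳ _) (+-identityʳ _)))
  ... | yes _ | no  τ≰θ = sym (cong (λ z → z * f a (θ ∸ τ a) * 1) (𝟙-no (τ a ≤? θ) τ≰θ))
  ... | no  _ | _       = sym (*-zeroʳ (arrival f a θ))

  departing-term f v θ a with src a ≟ v
  ... | yes _ = sym (*-identityʳ (f a θ))
  ... | no  _ = sym (*-zeroʳ (f a θ))

  _⊕_ : (Fin m → ℕ → ℕ) → (Fin m → ℕ → ℕ) → Fin m → ℕ → ℕ
  (f ⊕ g) a θ = f a θ + g a θ

  arriving-⊕ : ∀ f g v θ → arriving (f ⊕ g) v θ ≡ arriving f v θ + arriving g v θ
  arriving-⊕ f g v θ = trans (∑-cong (allFin m) (λ a → cong (_* δ (tgt a) v) (*-distribˡ-+ (𝟙 (τ a ≤? θ)) _ _)))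
                             (incident-+ tgt (λ a → arrival f a θ) (λ a → arrival g a θ) v)

  departing-⊕ : ∀ f g v θ → departing (f ⊕ g) v θ ≡ departing f v θ + departing g v θ
  departing-⊕ f g v θ = incident-+ src (λ a → f a θ) (λ a → g a θ) v

  unitFlow : Fin m → ℕ → ℕ → Fin m → ℕ → ℕ
  unitFlow b o k a θ = 𝟙 (b ≟ a) * window o k θ

  private
    unitFlow-off : ∀ b o k θ a → a ≢ b → unitFlow b o k a θ ≡ 0
    unitFlow-off b o k θ a a≢b = cong (_* window o k θ) (𝟙-no (b ≟ a) (a≢b ∘ sym))

    unitFlow-on : ∀ b o k θ → unitFlow b o k b θ ≡ window o k θ
    unitFlow-on b o k θ = trans (cong (_* window o k θ) (𝟙-yes (b ≟ b) refl)) (+-identityʳ _)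

  departing-unitFlow : ∀ b o k v θ → departing (unitFlow b o k) v θ ≡ window o k θ * δ (src b) v
  departing-unitFlow b o k v θ =
    trans (incident-single src (λ a → unitFlow b o k a θ) b v (unitFlow-off b o k θ)) (cong (_* δ (src b) v) (unitFlow-on b o k θ))

  arriving-unitFlow : ∀ b o k v θ → arriving (unitFlow b o k) v θ ≡ window (o + τ b) k θ * δ (tgt b) v
  arriving-unitFlow b o k v θ =
    trans (incident-single tgt (λ a → arrival (unitFlow b o k) a θ) b v
             (λ a a≢b → trans (cong (𝟙 (τ a ≤? θ) *_) (unitFlow-off b o k (θ ∸ τ a) a a≢b)) (*-zeroʳ (𝟙 (τ a ≤? θ)))))
          (cong (_* δ (tgt b) v) (trans (cong (𝟙 (τ b ≤? θ) *_) (unitFlow-on b o k (θ ∸ τ b))) (window-shift (τ b) o k θ)))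

  travelTime : List (Fin m) → ℕ
  travelTime Q = ∑ Q τ

  pathFlow : List (Fin m) → ℕ → ℕ → Fin m → ℕ → ℕ
  pathFlow []      o k = λ _ _ → 0
  pathFlow (b ∷ Q) o k = unitFlow b o k ⊕ pathFlow Q (o + τ b) k

  pathFlow-balance : ∀ {u Q w} o k → Connects D u Q w → ∀ v θ →
    departing (pathFlow Q o k) v θ + window (o + travelTime Q) k θ * δ w v ≡ window o k θ * δ u v + arriving (pathFlow Q o k) v θ
  pathFlow-balance {u} {[]} o k refl v θ = begin
    departing (λ _ _ → 0) v θ + window (o + 0) k θ * δ u v
      ≡⟨ cong₂ _+_ (incident-zero src v (λ _ → refl)) (cong (λ o′ → window o′ k θ * δ u v) (+-identityʳ o)) ⟩
    window o k θ * δ u v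
      ≡⟨ +-identityʳ _ ⟨
    window o k θ * δ u v + 0
      ≡⟨ cong (window o k θ * δ u v +_) (incident-zero tgt v (λ a → *-zeroʳ (𝟙 (τ a ≤? θ)))) ⟨
    window o k θ * δ u v + arriving (λ _ _ → 0) v θ ∎
    where open ≡-Reasoning
  pathFlow-balance {Q = b ∷ Q} {w} o k (refl , C) v θ = begin
    departing (unitFlow b o k ⊕ rest) v θ + window (o + (τ b + travelTime Q)) k θ * δ w v
      ≡⟨ cong₂ _+_ (departing-⊕ (unitFlow b o k) rest v θ) (cong (λ o′ → window o′ k θ * δ w v) (sym (+-assoc o (τ b) _))) ⟩
    departing (unitFlow b o k) v θ + departing rest v θ + window (o + τ b + travelTime Q) k θ * δ w v
      ≡⟨ +-assoc (departing (unitFlow b o k) v θ) _ _ ⟩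
    departing (unitFlow b o k) v θ + (departing rest v θ + window (o + τ b + travelTime Q) k θ * δ w v)
      ≡⟨ cong₂ _+_ (departing-unitFlow b o k v θ) (pathFlow-balance (o + τ b) k C v θ) ⟩
    window o k θ * δ (src b) v + (window (o + τ b) k θ * δ (tgt b) v + arriving rest v θ)
      ≡⟨ cong (λ i → window o k θ * δ (src b) v + (i + arriving rest v θ)) (arriving-unitFlow b o k v θ) ⟨
    window o k θ * δ (src b) v + (arriving (unitFlow b o k) v θ + arriving rest v θ)
      ≡⟨ cong (window o k θ * δ (src b) v +_) (arriving-⊕ (unitFlow b o k) rest v θ) ⟨
    window o k θ * δ (src b) v + arriving (unitFlow b o k ⊕ rest) v θ  ∎
    where
    open ≡-Reasoning
    rest = pathFlow Q (o + τ b) k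

  pathFlow-∉ : ∀ {Q} o k {a} θ → a ∉ Q → pathFlow Q o k a θ ≡ 0
  pathFlow-∉ {[]}    o k θ a∉ = refl
  pathFlow-∉ {b ∷ Q} o k {a} θ a∉ = cong₂ _+_ (unitFlow-off b o k θ a (a∉ ∘ here)) (pathFlow-∉ (o + τ b) k θ (a∉ ∘ there))

  pathFlow-≤1 : ∀ {Q} o k a θ → Unique Q → pathFlow Q o k a θ ≤ 1
  pathFlow-≤1 {[]}    o k a θ []           = z≤n
  pathFlow-≤1 {b ∷ Q} o k a θ (b∉Q ∷ uniq) with b ≟ a
  ... | yes refl = begin
    1 * window o k θ + pathFlow Q (o + τ a) k a θ     ≡⟨ cong₂ _+_ (*-identityˡ _) (pathFlow-∉ (o + τ a) k θ (All¬⇒¬Any b∉Q)) ⟩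
    window o k θ + 0                                  ≡⟨ +-identityʳ _ ⟩
    window o k θ                                      ≤⟨ 𝟙≤1 (inWindow? o k θ) ⟩
    1                                                 ∎
    where open ≤-Reasoning
  ... | no _ = pathFlow-≤1 (o + τ b) k a θ uniq

  pathFlow-horizon : ∀ {Q} o k a θ → 0 < pathFlow Q o k a θ → θ + τ a < o + travelTime Q + k
  pathFlow-horizon {b ∷ Q} o k a θ pos with pathFlow Q (o + τ b) k a θ ℕ.≟ 0
  ... | no rest≢0 = subst (θ + τ a <_) (cong (_+ k) (+-assoc o (τ b) _))
                          (pathFlow-horizon {Q} (o + τ b) k a θ (n≢0⇒n>0 rest≢0))
  ... | yes rest≡0 with 𝟙>0⇒ (b ≟ a ×-dec inWindow? o k θ) unit>0
    where
    unit>0 : 0 < 𝟙 (b ≟ a ×-dec inWindow? o k θ)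
    unit>0 = subst (0 <_) (trans (cong (unitFlow b o k a θ +_) rest≡0) (trans (+-identityʳ _) (𝟙-* (b ≟ a) (inWindow? o k θ)))) pos
  ...   | refl , _ , θ<o+k = begin-strict
    θ + τ a                      <⟨ +-monoˡ-< (τ a) θ<o+k ⟩
    o + k + τ a                  ≡⟨ xy∙z≈xz∙y o k (τ a) ⟩
    o + τ a + k                  ≤⟨ +-monoˡ-≤ k (+-monoʳ-≤ o (m≤m+n (τ a) (travelTime Q))) ⟩
    o + (τ a + travelTime Q) + k ∎
    where open ≤-Reasoning

  -- Every train crosses the cut over time of a potential

  -- The positive part of p (tgt a) − p (src a) − τ a, as ∸ truncates at 0.
  slack : (Fin n → ℕ) → Fin m → ℕ
  slack p a = p (tgt a) ∸ (p (src a) + τ a)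

  EntersAfter : (Fin m → ℕ) → ℕ → List (Fin m) → Set
  EntersAfter e β []      = ⊤
  EntersAfter e β (b ∷ _) = β ≤ e b

  timingOK-shift : ∀ (e : Fin m → ℕ) j Q → TimingOK D e Q → TimingOK D (λ a → e a + j) Q
  timingOK-shift e j []           _         = tt
  timingOK-shift e j (a ∷ [])     _         = tt
  timingOK-shift e j (a ∷ b ∷ Q) (le , ok) =
    ≤-trans (≤-reflexive (xy∙z≈xz∙y (e a) j (τ a))) (+-monoˡ-≤ j le) , timingOK-shift e j (b ∷ Q) ok

  -- If no arc were entered at or after p of its tail and left before p of its head, p at each vertex
  -- of the walk would be at most the time the walk is there; but the walk is done before p w.
  crossing : ∀ (p : Fin n → ℕ) (e : Fin m → ℕ) {u Q w} → Connects D u Q w → TimingOK D e Q →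
             EntersAfter e (p u) Q → (∀ a → a ∈ Q → e a + τ a < p w) → p u < p w →
             ∃ λ a → a ∈ Q × p (src a) ≤ e a × e a + τ a < p (tgt a)
  crossing p e {Q = []} refl _ _ _ pu<pw = ⊥-elim (<-irrefl refl pu<pw)
  crossing p e {Q = b ∷ Q} {w} (refl , C) ok enters exits pu<pw with e b + τ b <? p (tgt b)
  ... | yes crosses = b , here refl , enters , crosses
  ... | no ¬crosses =
    let a , a∈Q , rest = crossing p e C (tail ok) (next Q ok) (λ a a∈Q → exits a (there a∈Q)) ptgt<pw
    in a , there a∈Q , rest
    where
    ptgt≤ : p (tgt b) ≤ e b + τ b
    ptgt≤ = ≮⇒≥ ¬crosses
    ptgt<pw : p (tgt b) < p w
    ptgt<pw = ≤-<-trans ptgt≤ (exits b (here refl))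
    tail : ∀ {Q} → TimingOK D e (b ∷ Q) → TimingOK D e Q
    tail {[]}    _        = tt
    tail {_ ∷ _} (_ , ok) = ok
    next : ∀ Q → TimingOK D e (b ∷ Q) → EntersAfter e (p (tgt b)) Q
    next []      _        = tt
    next (_ ∷ _) (le , _) = ≤-trans ptgt≤ le

  crossing-window : ∀ p a {θ} → p (src a) ≤ θ → θ + τ a < p (tgt a) → InWindow (p (src a)) (slack p a) θ
  crossing-window p a {θ} ps≤θ θ+τ<pt = ps≤θ , +-cancelʳ-< (τ a) θ _ (begin-strict
    θ + τ a                                   <⟨ θ+τ<pt ⟩
    p (tgt a)                                 ≡⟨ m+[n∸m]≡n ps+τ≤pt ⟨
    p (src a) + τ a + slack p a               ≡⟨ xy∙z≈xz∙y (p (src a)) (τ a) (slack p a) ⟩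
    p (src a) + slack p a + τ a               ∎)
    where
    open ≤-Reasoning
    ps+τ≤pt : p (src a) + τ a ≤ p (tgt a)
    ps+τ≤pt = <⇒≤ (≤-<-trans (+-monoˡ-≤ (τ a) ps≤θ) θ+τ<pt)

  module _ {s t : Fin n} {d Δ : ℕ} (S : Schedule D d) (feasible : Feasible D S s t Δ)
           (p : Fin n → ℕ) (p-s : p s ≡ 0) (p-t : makespan D S + Δ ≤ p t) where
    open Schedule S

    private
      onPath : Fin d → Fin m → ℕ
      onPath i a = 𝟙 (a ∈? path i)

      cutWindow : Fin m → ℕ → ℕ
      cutWindow a = window (p (src a)) (slack p a)

    exit≤makespan : ∀ i a → a ∈ path i → entry i a + τ a ≤ makespan D S
    exit≤makespan i a a∈ = ≤-trans (∈⇒≤max (λ b → entry i b + τ b) a∈)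
                                   (∈⇒≤max (λ i′ → foldr _⊔_ 0 (map (λ b → entry i′ b + τ b) (path i′))) (∈-allFin i))

    train-crosses : ∀ i j → j < Δ → ∃ λ a → a ∈ path i × InWindow (p (src a)) (slack p a) (entry i a + j)
    train-crosses i j j<Δ =
      let a , a∈ , ps≤ , crosses = crossing p (λ a → entry i a + j) connects timing enters exits ps<pt
      in a , a∈ , crossing-window p a ps≤ crosses
      where
      connects = proj₁ (proj₁ (proj₁ feasible i))
      timing = timingOK-shift (entry i) j (path i) (proj₂ (proj₁ feasible i))
      enters : EntersAfter (λ a → entry i a + j) (p s) (path i)
      enters with path i
      ... | []    = tt
      ... | _ ∷ _ = subst (_≤ _) (sym p-s) z≤n
      exits : ∀ a → a ∈ path i → entry i a + j + τ a < p t
      exits a a∈ = begin-strict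
        entry i a + j + τ a      ≡⟨ xy∙z≈xz∙y (entry i a) j (τ a) ⟩
        entry i a + τ a + j      <⟨ +-mono-≤-< (exit≤makespan i a a∈) j<Δ ⟩
        makespan D S + Δ         ≤⟨ p-t ⟩
        p t                      ∎
        where open ≤-Reasoning
      ps<pt : p s < p t
      ps<pt = subst (_< p t) (sym p-s) (<-≤-trans (≤-<-trans z≤n j<Δ) (≤-trans (m≤n+m Δ _) p-t))

    headway : ∀ a θ → ∑[ i ∈ allFin d ] (onPath i a * window (entry i a) Δ θ) ≤ 1
    headway a θ = ∑-allFin-≤1 _ (λ i → *-mono-≤ (𝟙≤1 (a ∈? path i)) (𝟙≤1 (inWindow? (entry i a) Δ θ))) same
      where
      using-a : ∀ i → 0 < onPath i a * window (entry i a) Δ θ → a ∈ path i × InWindow (entry i a) Δ θ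
      using-a i pos = 𝟙>0⇒ (a ∈? path i ×-dec inWindow? (entry i a) Δ θ)
                           (subst (0 <_) (𝟙-* (a ∈? path i) (inWindow? (entry i a) Δ θ)) pos)
      same : ∀ i i′ → 0 < onPath i a * window (entry i a) Δ θ → 0 < onPath i′ a * window (entry i′ a) Δ θ → i ≡ i′
      same i i′ pos pos′ with i ≟ i′
      ... | yes i≡i′ = i≡i′
      ... | no  i≢i′ = ⊥-elim (<⇒≱ (windows-close (proj₂ (using-a i pos)) (proj₂ (using-a i′ pos′)))
                                   (proj₂ feasible i i′ i≢i′ a (proj₁ (using-a i pos)) (proj₁ (using-a i′ pos′))))

    -- By the headway, distinct trains enter a at least Δ apart, so each time step of a's
    -- window is hit by at most one pair (i , j).
    arc-load : ∀ a → ∑[ i ∈ allFin d ] (∑[ j ∈ upTo Δ ] (onPath i a * cutWindow a (entry i a + j))) ≤ slack p a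
    arc-load a = begin
      ∑[ i ∈ allFin d ] (∑[ j ∈ upTo Δ ] (onPath i a * c (e i + j)))
        ≤⟨ ∑-mono (allFin d) (λ i → ∑-mono (upTo Δ) (λ j → ≤-∑-pick (λ θ → onPath i a * c θ) (before-N i j))) ⟩
      ∑[ i ∈ allFin d ] (∑[ j ∈ upTo Δ ] (∑[ θ ∈ upTo N ] (𝟙 (e i + j ℕ.≟ θ) * (onPath i a * c θ))))
        ≡⟨ ∑-cong (allFin d) (λ i → ∑-comm (upTo Δ) (upTo N) _) ⟩
      ∑[ i ∈ allFin d ] (∑[ θ ∈ upTo N ] (∑[ j ∈ upTo Δ ] (𝟙 (e i + j ℕ.≟ θ) * (onPath i a * c θ))))
        ≡⟨ ∑-comm (allFin d) (upTo N) _ ⟩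
      ∑[ θ ∈ upTo N ] (∑[ i ∈ allFin d ] (∑[ j ∈ upTo Δ ] (𝟙 (e i + j ℕ.≟ θ) * (onPath i a * c θ))))
        ≡⟨ ∑-cong (upTo N) (λ θ → trans (∑-cong (allFin d) (λ i → sum-offsets i θ))
                                        (sym (∑-distribˡ (allFin d) (c θ) _))) ⟩
      ∑[ θ ∈ upTo N ] (c θ * ∑[ i ∈ allFin d ] (onPath i a * window (e i) Δ θ))
        ≤⟨ ∑-mono (upTo N) (λ θ → ≤-trans (*-monoʳ-≤ (c θ) (headway a θ)) (≤-reflexive (*-identityʳ (c θ)))) ⟩
      ∑[ θ ∈ upTo N ] c θ
        ≡⟨ ∑-window {p (src a)} {slack p a} ≤-refl ⟩
      slack p a ∎
      where
      open ≤-Reasoning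
      c = cutWindow a
      e = λ i → entry i a
      N = p (src a) + slack p a
      before-N : ∀ i j → 0 < onPath i a * c (e i + j) → e i + j < N
      before-N i j pos = proj₂ (proj₂ (𝟙>0⇒ (a ∈? path i ×-dec inWindow? (p (src a)) (slack p a) (e i + j))
                                            (subst (0 <_) (𝟙-* (a ∈? path i) (inWindow? (p (src a)) (slack p a) (e i + j))) pos)))
      sum-offsets : ∀ i θ → ∑[ j ∈ upTo Δ ] (𝟙 (e i + j ℕ.≟ θ) * (onPath i a * c θ)) ≡ c θ * (onPath i a * window (e i) Δ θ)
      sum-offsets i θ = begin-equality
        ∑[ j ∈ upTo Δ ] (𝟙 (e i + j ℕ.≟ θ) * (onPath i a * c θ))    ≡⟨ ∑-cong (upTo Δ) (λ j → *-comm (𝟙 (e i + j ℕ.≟ θ)) _) ⟩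
        ∑[ j ∈ upTo Δ ] (onPath i a * c θ * 𝟙 (e i + j ℕ.≟ θ))      ≡⟨ ∑-distribˡ (upTo Δ) (onPath i a * c θ) _ ⟨
        onPath i a * c θ * ∑[ j ∈ upTo Δ ] 𝟙 (e i + j ℕ.≟ θ)        ≡⟨ cong (onPath i a * c θ *_) (∑-offsets (e i) Δ θ) ⟩
        onPath i a * c θ * window (e i) Δ θ                          ≡⟨ rearrange (onPath i a) (c θ) (window (e i) Δ θ) ⟩
        c θ * (onPath i a * window (e i) Δ θ)                        ∎
        where
        rearrange : ∀ x y z → x * y * z ≡ y * (x * z)
        rearrange = solve-∀

    trains-bound : d * Δ ≤ ∑[ a ∈ allFin m ] slack p a
    trains-bound = begin
      d * Δ
        ≡⟨ cong (d *_) (*-identityʳ Δ) ⟨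
      d * (Δ * 1)
        ≡⟨ cong₂ (λ d′ Δ′ → d′ * (Δ′ * 1)) (length-tabulate {n = d} id) (length-upTo Δ) ⟨
      length (allFin d) * (length (upTo Δ) * 1)
        ≡⟨ trans (∑-const (allFin d) _) (cong (length (allFin d) *_) (∑-const (upTo Δ) 1)) ⟨
      ∑[ i ∈ allFin d ] ∑ (upTo Δ) (λ _ → 1)
        ≤⟨ ∑-mono (allFin d) (λ i → ∑-mono-∈ (upTo Δ) (λ j j∈ → crossed i j (∈-upTo⁻ j∈))) ⟩
      ∑[ i ∈ allFin d ] (∑[ j ∈ upTo Δ ] (∑[ a ∈ allFin m ] (onPath i a * cutWindow a (entry i a + j))))
        ≡⟨ ∑-cong (allFin d) (λ i → ∑-comm (upTo Δ) (allFin m) _) ⟩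
      ∑[ i ∈ allFin d ] (∑[ a ∈ allFin m ] (∑[ j ∈ upTo Δ ] (onPath i a * cutWindow a (entry i a + j))))
        ≡⟨ ∑-comm (allFin d) (allFin m) _ ⟩
      ∑[ a ∈ allFin m ] (∑[ i ∈ allFin d ] (∑[ j ∈ upTo Δ ] (onPath i a * cutWindow a (entry i a + j))))
        ≤⟨ ∑-mono (allFin m) arc-load ⟩
      ∑[ a ∈ allFin m ] slack p a ∎
      where
      open ≤-Reasoning
      crossed : ∀ i j → j < Δ → 1 ≤ ∑[ a ∈ allFin m ] (onPath i a * cutWindow a (entry i a + j))
      crossed i j j<Δ =
        let a , a∈ , inW = train-crosses i j j<Δ
        in ≤-trans (≤-reflexive (sym (cong₂ _*_ (𝟙-yes (a ∈? path i) a∈)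
                                               (𝟙-yes (inWindow? (p (src a)) (slack p a) (entry i a + j)) inW))))
                   (∈⇒≤∑ (λ a → onPath i a * cutWindow a (entry i a + j)) (∈-allFin a))

  module _ {s t : Fin n} (s≢t : s ≢ t) where

    -- Minimum-cost flows by the primal-dual method

    record IsFlow (x : Fin m → Bool) (val : ℕ) : Set where
      field
        conserved : ∀ v → v ≢ s → v ≢ t → inCount x v ≡ outCount x v
        value     : inCount x t ≡ outCount x t + val

    isFlow-empty : IsFlow (λ _ → false) 0
    isFlow-empty = record
      { conserved = λ v _ _ → trans (empty tgt v) (sym (empty src v))
      ; value     = trans (empty tgt t) (sym (trans (+-identityʳ _) (empty src t)))
      }
      where
      empty : ∀ h v → incident h (λ _ → 0) v ≡ 0
      empty h v = incident-zero h v (λ _ → refl)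

    shifted-conserved : ∀ {x y u w v} → Shifted x y u w → v ≢ u → v ≢ w →
                        inCount x v ≡ outCount x v → inCount y v ≡ outCount y v
    shifted-conserved {x} {y} {u} {w} {v} x→y v≢u v≢w x-conserved = +-cancelʳ-≡ (outCount x v) _ _ (begin
      inCount y v + outCount x v               ≡⟨ +-identityʳ _ ⟨
      inCount y v + outCount x v + 0           ≡⟨ cong (inCount y v + outCount x v +_) (δ-≢ (v≢u ∘ sym)) ⟨
      inCount y v + outCount x v + δ u v       ≡⟨ balance x→y v ⟩
      outCount y v + inCount x v + δ w v       ≡⟨ cong₂ (λ i d → outCount y v + i + d) x-conserved (δ-≢ (v≢w ∘ sym)) ⟩
      outCount y v + outCount x v + 0          ≡⟨ +-identityʳ _ ⟩
      outCount y v + outCount x v              ∎)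
      where open ≡-Reasoning

    augment-isFlow : ∀ {x y val} → Shifted x y s t → IsFlow x val → IsFlow y (suc val)
    augment-isFlow {x} {y} {val} x→y F = record
      { conserved = λ v v≢s v≢t → shifted-conserved x→y v≢s v≢t (IsFlow.conserved F v v≢s v≢t)
      ; value     = +-cancelʳ-≡ (outCount x t) _ _ (begin
          inCount y t + outCount x t                 ≡⟨ +-identityʳ _ ⟨
          inCount y t + outCount x t + 0             ≡⟨ cong (inCount y t + outCount x t +_) (δ-≢ s≢t) ⟨
          inCount y t + outCount x t + δ s t         ≡⟨ balance x→y t ⟩
          outCount y t + inCount x t + δ t t         ≡⟨ cong₂ (λ i d → outCount y t + i + d) (IsFlow.value F) (δ-refl t) ⟩
          outCount y t + (outCount x t + val) + 1    ≡⟨ regroup (outCount y t) (outCount x t) val ⟩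
          outCount y t + suc val + outCount x t      ∎)
      }
      where
      open ≡-Reasoning
      regroup : ∀ a b c → a + (b + c) + 1 ≡ a + suc c + b
      regroup = solve-∀

    remove-isFlow : ∀ {x y val} → Shifted x y t s → IsFlow x (suc val) → IsFlow y val
    remove-isFlow {x} {y} {val} x→y F = record
      { conserved = λ v v≢s v≢t → shifted-conserved x→y v≢t v≢s (IsFlow.conserved F v v≢s v≢t)
      ; value     = +-cancelʳ-≡ (suc (outCount x t)) _ _ (begin
          inCount y t + suc (outCount x t)               ≡⟨ +-suc _ _ ⟩
          suc (inCount y t + outCount x t)               ≡⟨ +-comm 1 _ ⟩
          inCount y t + outCount x t + 1                 ≡⟨ cong (inCount y t + outCount x t +_) (δ-refl t) ⟨
          inCount y t + outCount x t + δ t t             ≡⟨ balance x→y t ⟩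
          outCount y t + inCount x t + δ s t             ≡⟨ cong₂ (λ i d → outCount y t + i + d) (IsFlow.value F) (δ-≢ s≢t) ⟩
          outCount y t + (outCount x t + suc val) + 0    ≡⟨ regroup (outCount y t) (outCount x t) val ⟩
          outCount y t + val + suc (outCount x t)        ∎)
      }
      where
      open ≡-Reasoning
      regroup : ∀ a b c → a + (b + suc c) + 0 ≡ a + c + suc b
      regroup = solve-∀

    value≤m : ∀ {x val} → IsFlow x val → val ≤ m
    value≤m {x} {val} F = begin
      val                          ≤⟨ m≤n+m val _ ⟩
      outCount x t + val           ≡⟨ IsFlow.value F ⟨
      inCount x t                  ≤⟨ incident-≤ tgt (bit ∘ x) t (bit≤1 ∘ x) ⟩
      m                            ∎
      where open ≤-Reasoning

    Tight : (Fin n → ℕ) → Fin m → Set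
    Tight p a = p (tgt a) ≡ p (src a) + τ a

    -- Complementary slackness for the minimum-cost flow problem with costs τ and node potentials p.
    record Compatible (x : Fin m → Bool) (p : Fin n → ℕ) : Set where
      field
        idle : ∀ a → x a ≡ false → p (tgt a) ≤ p (src a) + τ a
        busy : ∀ a → x a ≡ true  → p (src a) + τ a ≤ p (tgt a)

    compatible-toggleAll : ∀ {x p} Q → All (Tight p) Q → Compatible x p → Compatible (toggleAll Q x) p
    compatible-toggleAll {x} {p} Q tight C = record { idle = idle′ ; busy = busy′ }
      where
      idle′ : ∀ a → toggleAll Q x a ≡ false → p (tgt a) ≤ p (src a) + τ a
      idle′ a xa with a ∈? Q
      ... | yes a∈Q = ≤-reflexive (All.lookup tight a∈Q)
      ... | no  a∉Q = Compatible.idle C a (trans (sym (toggleAll-∉ Q x a∉Q)) xa)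
      busy′ : ∀ a → toggleAll Q x a ≡ true → p (src a) + τ a ≤ p (tgt a)
      busy′ a xa with a ∈? Q
      ... | yes a∈Q = ≤-reflexive (sym (All.lookup tight a∈Q))
      ... | no  a∉Q = Compatible.busy C a (trans (sym (toggleAll-∉ Q x a∉Q)) xa)

    raise : (Fin n → Bool) → (Fin n → ℕ) → Fin n → ℕ
    raise R p v = p v + bit (not (R v))

    private
      raise-mono : ∀ (R : Fin n → Bool) {a b} u v → a ≤ b → (R v ≡ true → R u ≡ false → a < b) →
                   a + bit (not (R u)) ≤ b + bit (not (R v))
      raise-mono R {a} {b} u v a≤b strict with R u | R v
      ... | r     | false = +-mono-≤ a≤b (bit≤1 (not r))
      ... | true  | true  = +-monoˡ-≤ 0 a≤b
      ... | false | true  = ≤-trans (≤-reflexive (+-comm a 1)) (≤-trans (strict refl refl) (≤-reflexive (sym (+-identityʳ b))))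

    Admissible : (Fin m → Bool) → (Fin n → ℕ) → Edge → Set
    Admissible x p e = Residual x e × Tight p (arc e)

    admissible? : ∀ x p → Decidable (Admissible x p)
    admissible? x p (fwd a) = x a Bool.≟ false ×-dec p (tgt a) ℕ.≟ p (src a) + τ a
    admissible? x p (bwd a) = x a Bool.≟ true  ×-dec p (tgt a) ℕ.≟ p (src a) + τ a

    compatible-raise : ∀ {x p R} → Closed (Admissible x p) R → Compatible x p → Compatible x (raise R p)
    compatible-raise {x} {p} {R} closed C = record { idle = idle′ ; busy = busy′ }
      where
      idle′ : ∀ a → x a ≡ false → raise R p (tgt a) ≤ raise R p (src a) + τ a
      idle′ a xa = ≤-trans (raise-mono R (tgt a) (src a) (Compatible.idle C a xa) strict)
                           (≤-reflexive (xy∙z≈xz∙y (p (src a)) (τ a) _))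
        where
        strict : R (src a) ≡ true → R (tgt a) ≡ false → p (tgt a) < p (src a) + τ a
        strict Rsrc Rtgt = ≤∧≢⇒< (Compatible.idle C a xa)
          (λ tight → case trans (sym (closed (fwd a) (xa , tight) Rsrc)) Rtgt of λ ())
      busy′ : ∀ a → x a ≡ true → raise R p (src a) + τ a ≤ raise R p (tgt a)
      busy′ a xa = ≤-trans (≤-reflexive (xy∙z≈xz∙y (p (src a)) _ (τ a)))
                           (raise-mono R (src a) (tgt a) (Compatible.busy C a xa) strict)
        where
        strict : R (tgt a) ≡ true → R (src a) ≡ false → p (src a) + τ a < p (tgt a)
        strict Rtgt Rsrc = ≤∧≢⇒< (Compatible.busy C a xa)
          (λ tight → case trans (sym (closed (bwd a) (xa , sym tight) Rtgt)) Rsrc of λ ())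

    record Invariant (x : Fin m → Bool) (p : Fin n → ℕ) (val : ℕ) : Set where
      field
        isFlow     : IsFlow x val
        compatible : Compatible x p
        source     : p s ≡ 0

    record PrimalDualPair (T : ℕ) : Set where
      field
        flow      : Fin m → Bool
        potential : Fin n → ℕ
        value     : ℕ
        invariant : Invariant flow potential value
        sink      : potential t ≡ T

    private
      record Blocked (p : Fin n → ℕ) : Set where
        field
          flow      : Fin m → Bool
          value     : ℕ
          invariant : Invariant flow p value
          cut       : Fin n → Bool
          cut-s     : cut s ≡ true
          cut-t     : cut t ≡ false
          closed    : Closed (Admissible flow p) cut

      augment : ∀ {x p val} P → Walk s P t → All (Admissible x p) P → Unique (arcs P) →
                Invariant x p val → Invariant (toggleAll (arcs P) x) p (suc val)
      augment {x} P W adm uniq I = record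
        { isFlow     = augment-isFlow (augment-shifted x W (All.map proj₁ adm) uniq) (Invariant.isFlow I)
        ; compatible = compatible-toggleAll (arcs P) (map⁺ (All.map proj₂ adm)) (Invariant.compatible I)
        ; source     = Invariant.source I
        }

      saturate : ∀ {x p val} (fuel : ℕ) → m ≤ val + fuel → Invariant x p val → Blocked p
      saturate {x} {p} {val} fuel bound I with Search.search (admissible? x p) s t
      ... | Search.cut R Rs Rt closed = record
        { flow = x ; value = val ; invariant = I ; cut = R ; cut-s = Rs ; cut-t = Rt ; closed = closed }
      ... | Search.path P W adm uniq with fuel
      ...   | suc fuel = saturate fuel (≤-trans bound (≤-reflexive (+-suc val fuel))) (augment P W adm uniq I)
      ...   | zero     = ⊥-elim (<⇒≱ (value≤m (Invariant.isFlow (augment P W adm uniq I)))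
                                     (≤-trans bound (≤-reflexive (+-identityʳ val))))

      raise-blocked : ∀ {p} (B : Blocked p) → Invariant (Blocked.flow B) (raise (Blocked.cut B) p) (Blocked.value B)
      raise-blocked {p} B = record
        { isFlow     = Invariant.isFlow I
        ; compatible = compatible-raise (Blocked.closed B) (Invariant.compatible I)
        ; source     = trans (cong (λ r → p s + bit (not r)) (Blocked.cut-s B)) (trans (+-identityʳ _) (Invariant.source I))
        }
        where I = Blocked.invariant B

      -- Each round saturates the tight residual graph and then raises by one the potential of every
      -- vertex that can still reach t, so p t grows by exactly one per round.
      grow : ∀ {x p val T} (gap : ℕ) → p t + gap ≡ T → Invariant x p val → PrimalDualPair T
      grow {x} {p} {val} zero    eq I = record
        { flow = x ; potential = p ; value = val ; invariant = I ; sink = trans (sym (+-identityʳ _)) eq }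
      grow {x} {p} {val} (suc gap) eq I = grow gap (trans raised-t eq) (raise-blocked B)
        where
        B = saturate m (m≤n+m m val) I
        raised-t : raise (Blocked.cut B) p t + gap ≡ p t + suc gap
        raised-t = trans (cong (λ r → p t + bit (not r) + gap) (Blocked.cut-t B)) (+-assoc (p t) 1 gap)

    primalDual : ∀ T → PrimalDualPair T
    primalDual T = grow T refl (record { isFlow = isFlow-empty ; compatible = zero-compatible ; source = refl })
      where
      zero-compatible : Compatible (λ _ → false) (λ _ → 0)
      zero-compatible = record { idle = λ _ _ → z≤n ; busy = λ _ () }

    weighted-balance : ∀ {x val} → IsFlow x val → (w : Fin n → ℕ) → w s ≡ 0 →
                       weight x (w ∘ tgt) ≡ weight x (w ∘ src) + w t * val
    weighted-balance {x} {val} F w ws≡0 = begin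
      weight x (w ∘ tgt)                                              ≡⟨ ∑-incident tgt (bit ∘ x) w ⟨
      ∑[ v ∈ allFin n ] (w v * inCount x v)                           ≡⟨ ∑-cong (allFin n) per-vertex ⟩
      ∑[ v ∈ allFin n ] (w v * outCount x v + δ t v * (w v * val))    ≡⟨ ∑-distrib-+ (allFin n) _ _ ⟩
      ∑[ v ∈ allFin n ] (w v * outCount x v) + ∑[ v ∈ allFin n ] (δ t v * (w v * val))
        ≡⟨ cong₂ _+_ (∑-incident src (bit ∘ x) w) (∑-δ t (λ v → w v * val)) ⟩
      weight x (w ∘ src) + w t * val                                  ∎
      where
      open ≡-Reasoning
      per-vertex : ∀ v → w v * inCount x v ≡ w v * outCount x v + δ t v * (w v * val)
      per-vertex v with v ≟ t | v ≟ s
      ... | yes refl | _ = begin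
        w t * inCount x t                       ≡⟨ cong (w t *_) (IsFlow.value F) ⟩
        w t * (outCount x t + val)              ≡⟨ *-distribˡ-+ (w t) _ val ⟩
        w t * outCount x t + w t * val          ≡⟨ cong (w t * outCount x t +_) (trans (*-comm (δ t t) _) (*δ-refl _ t)) ⟨
        w t * outCount x t + δ t t * (w t * val) ∎
      ... | no v≢t | yes refl rewrite ws≡0 = sym (*-zeroʳ (δ t s))
      ... | no v≢t | no v≢s = begin
        w v * inCount x v                       ≡⟨ cong (w v *_) (IsFlow.conserved F v v≢s v≢t) ⟩
        w v * outCount x v                      ≡⟨ +-identityʳ _ ⟨
        w v * outCount x v + 0                  ≡⟨ cong (λ d → w v * outCount x v + d * (w v * val)) (δ-≢ (v≢t ∘ sym)) ⟨
        w v * outCount x v + δ t v * (w v * val) ∎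

    -- Ford–Fulkerson: the temporally repeated flow of x has value p t · val − cost(x), its total slack.
    slack+cost : ∀ {x p val} → IsFlow x val → (∀ a → x a ≡ true → p (src a) + τ a ≤ p (tgt a)) → p s ≡ 0 →
                 weight x (slack p) + weight x τ ≡ p t * val
    slack+cost {x} {p} {val} F busy ps≡0 = +-cancelʳ-≡ (weight x (p ∘ src)) _ _ (begin
      weight x (slack p) + weight x τ + weight x (p ∘ src)   ≡⟨ regroup ⟨
      weight x (λ a → slack p a + τ a + p (src a))           ≡⟨ ∑-cong (allFin m) per-arc ⟩
      weight x (p ∘ tgt)                                     ≡⟨ weighted-balance F p ps≡0 ⟩
      weight x (p ∘ src) + p t * val                         ≡⟨ +-comm _ (p t * val) ⟩
      p t * val + weight x (p ∘ src)                         ∎)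
      where
      open ≡-Reasoning
      per-arc : ∀ a → bit (x a) * (slack p a + τ a + p (src a)) ≡ bit (x a) * p (tgt a)
      per-arc a with x a in xa
      ... | false = refl
      ... | true  = cong (_+ 0) (trans (+-assoc (slack p a) (τ a) _)
                      (trans (cong (slack p a +_) (+-comm (τ a) (p (src a)))) (m∸n+n≡m (busy a xa))))
      regroup : weight x (λ a → slack p a + τ a + p (src a)) ≡ weight x (slack p) + weight x τ + weight x (p ∘ src)
      regroup = trans (∑-cong (allFin m) (λ a → trans (*-distribˡ-+ (bit (x a)) _ _)
                                                       (cong (_+ bit (x a) * p (src a)) (*-distribˡ-+ (bit (x a)) _ _))))
                      (trans (∑-distrib-+ (allFin m) _ _) (cong (_+ weight x (p ∘ src)) (∑-distrib-+ (allFin m) _ _)))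

    Used : (Fin m → Bool) → Edge → Set
    Used x (fwd a) = x a ≡ true
    Used x (bwd a) = ⊥

    used? : ∀ x → Decidable (Used x)
    used? x (fwd a) = x a Bool.≟ true
    used? x (bwd a) = no λ ()

    cut⇒value≡0 : ∀ {x val R} → IsFlow x val → Closed (Used x) R → R s ≡ true → R t ≡ false → val ≡ 0
    cut⇒value≡0 {x} {val} {R} F closed Rs Rt = n≤0⇒n≡0 (+-cancelˡ-≤ (weight x (w ∘ src)) val 0 (begin
      weight x (w ∘ src) + val                 ≡⟨ cong (weight x (w ∘ src) +_) (+-identityʳ val) ⟨
      weight x (w ∘ src) + 1 * val             ≡⟨ cong (λ r → weight x (w ∘ src) + bit (not r) * val) Rt ⟨
      weight x (w ∘ src) + w t * val           ≡⟨ weighted-balance F w (cong (bit ∘ not) Rs) ⟨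
      weight x (w ∘ tgt)                       ≤⟨ ∑-mono (allFin m) per-arc ⟩
      weight x (w ∘ src)                       ≡⟨ +-identityʳ _ ⟨
      weight x (w ∘ src) + 0                   ∎))
      where
      open ≤-Reasoning
      w : Fin n → ℕ
      w v = bit (not (R v))
      per-arc : ∀ a → bit (x a) * w (tgt a) ≤ bit (x a) * w (src a)
      per-arc a with x a in xa | R (tgt a) in Rtgt | R (src a) in Rsrc
      ... | false | _     | _     = z≤n
      ... | true  | true  | _     = z≤n
      ... | true  | false | false = ≤-refl
      ... | true  | false | true  = case trans (sym (closed (fwd a) xa Rsrc)) Rtgt of λ ()

    used-true : ∀ {x} e → Used x e → x (arc e) ≡ true
    used-true (fwd a) xa = xa

    used-walk⇒connects : ∀ {x u P w} → Walk u P w → All (Used x) P → Connects D u (arcs P) w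
    used-walk⇒connects {P = []}        refl       []       = refl
    used-walk⇒connects {P = fwd a ∷ P} (refl , W) (_ ∷ us) = refl , used-walk⇒connects W us

    ∑-slack≡weight : ∀ {x p} → Compatible x p → ∑[ a ∈ allFin m ] slack p a ≡ weight x (slack p)
    ∑-slack≡weight {x} {p} C = ∑-cong (allFin m) per-arc
      where
      per-arc : ∀ a → slack p a ≡ bit (x a) * slack p a
      per-arc a with x a in xa
      ... | true  = sym (+-identityʳ _)
      ... | false = m≤n⇒m∸n≡0 (Compatible.idle C a xa)

    module _ {Q : List (Fin m)} (C : Connects D s Q t) (k : ℕ) where

      pathFlow-conserved : ∀ {v} → v ≢ s → v ≢ t → ∀ θ →
                           arriving (pathFlow Q 0 k) v θ ≡ departing (pathFlow Q 0 k) v θ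
      pathFlow-conserved {v} v≢s v≢t θ = begin
        arriving P v θ                                        ≡⟨ cong (_+ arriving P v θ) (*δ-≢ (window 0 k θ) (v≢s ∘ sym)) ⟨
        window 0 k θ * δ s v + arriving P v θ                 ≡⟨ pathFlow-balance 0 k C v θ ⟨
        departing P v θ + window (travelTime Q) k θ * δ t v
          ≡⟨ cong (departing P v θ +_) (*δ-≢ (window (travelTime Q) k θ) (v≢t ∘ sym)) ⟩
        departing P v θ + 0                                   ≡⟨ +-identityʳ _ ⟩
        departing P v θ                                       ∎
        where
        open ≡-Reasoning
        P = pathFlow Q 0 k

      pathFlow-sink : ∀ θ → arriving (pathFlow Q 0 k) t θ ≡ departing (pathFlow Q 0 k) t θ + window (travelTime Q) k θ
      pathFlow-sink θ = begin
        arriving P t θ                                        ≡⟨ cong (_+ arriving P t θ) (*δ-≢ (window 0 k θ) s≢t) ⟨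
        window 0 k θ * δ s t + arriving P t θ                 ≡⟨ pathFlow-balance 0 k C t θ ⟨
        departing P t θ + window (travelTime Q) k θ * δ t t   ≡⟨ cong (departing P t θ +_) (*δ-refl (window (travelTime Q) k θ) t) ⟩
        departing P t θ + window (travelTime Q) k θ           ∎
        where
        open ≡-Reasoning
        P = pathFlow Q 0 k

    -- Temporally repeated flows

    module TemporallyRepeated {T : ℕ} (p : Fin n → ℕ) (p-s : p s ≡ 0) (p-t : p t ≡ T) where

      Busy : (Fin m → Bool) → Set
      Busy x = ∀ a → x a ≡ true → p (src a) + τ a ≤ p (tgt a)

      record FlowOverTimeOn (x : Fin m → Bool) (V : ℕ) : Set where
        field
          f         : Fin m → ℕ → ℕ
          capacity  : ∀ a θ → f a θ ≤ 1
          horizon   : ∀ a θ → T < suc (θ + τ a) → f a θ ≡ 0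
          conserved : ∀ v → v ≢ s → v ≢ t → ∀ θ → arriving f v θ ≡ departing f v θ
          value     : ∑[ θ ∈ upTo T ] arriving f t θ ≡ ∑[ θ ∈ upTo T ] departing f t θ + V
          within    : ∀ a θ → x a ≡ false → f a θ ≡ 0

      zeroFlow : ∀ {x} → FlowOverTimeOn x 0
      zeroFlow = record
        { f         = λ _ _ → 0
        ; capacity  = λ _ _ → z≤n
        ; horizon   = λ _ _ _ → refl
        ; conserved = λ v _ _ θ → trans (none-arriving v θ) (sym (none-departing v θ))
        ; value     = trans (∑-zero (upTo T) (none-arriving t)) (sym (trans (+-identityʳ _) (∑-zero (upTo T) (none-departing t))))
        ; within    = λ _ _ _ → refl
        }
        where
        none-arriving : ∀ v θ → arriving (λ _ _ → 0) v θ ≡ 0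
        none-arriving v θ = incident-zero tgt v (λ a → *-zeroʳ (𝟙 (τ a ≤? θ)))
        none-departing : ∀ v θ → departing (λ _ _ → 0) v θ ≡ 0
        none-departing v θ = incident-zero src v (λ _ → refl)

      telescope : ∀ {u Q w} → Connects D u Q w → All (λ a → p (src a) + τ a ≤ p (tgt a)) Q →
                  p u + (travelTime Q + ∑ Q (slack p)) ≡ p w
      telescope {Q = []}    refl       []        = +-identityʳ _
      telescope {Q = b ∷ Q} (refl , C) (le ∷ les) = begin
        p (src b) + (τ b + travelTime Q + (slack p b + ∑ Q (slack p)))  ≡⟨ cong (p (src b) +_) (interchange (τ b) _ (slack p b) _) ⟩
        p (src b) + (τ b + slack p b + (travelTime Q + ∑ Q (slack p)))  ≡⟨ +-assoc (p (src b)) _ _ ⟨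
        p (src b) + (τ b + slack p b) + (travelTime Q + ∑ Q (slack p))  ≡⟨ cong (_+ (travelTime Q + ∑ Q (slack p))) arrive ⟩
        p (tgt b) + (travelTime Q + ∑ Q (slack p))                      ≡⟨ telescope C les ⟩
        p _                                                             ∎
        where
        open ≡-Reasoning
        arrive : p (src b) + (τ b + slack p b) ≡ p (tgt b)
        arrive = trans (sym (+-assoc (p (src b)) (τ b) _)) (m+[n∸m]≡n le)

      module _ {x Q V k} (C : Connects D s Q t) (uniq : Unique Q) (xQ : All (λ a → x a ≡ true) Q)
               (travel+k≤T : travelTime Q + k ≤ T) (G : FlowOverTimeOn (toggleAll Q x) V) where
        open FlowOverTimeOn G renaming (f to g)

        private
          P : Fin m → ℕ → ℕ
          P = pathFlow Q 0 k

          idle-on-path : ∀ {a} → a ∈ Q → toggleAll Q x a ≡ false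
          idle-on-path a∈Q = trans (toggleAll-∈ x uniq a∈Q) (cong not (All.lookup xQ a∈Q))

          capacity-⊕ : ∀ a θ → g a θ + P a θ ≤ 1
          capacity-⊕ a θ with a ∈? Q
          ... | yes a∈Q = subst (λ r → r + P a θ ≤ 1) (sym (within a θ (idle-on-path a∈Q))) (pathFlow-≤1 0 k a θ uniq)
          ... | no  a∉Q = subst (λ r → g a θ + r ≤ 1) (sym (pathFlow-∉ 0 k θ a∉Q))
                                (subst (_≤ 1) (sym (+-identityʳ (g a θ))) (capacity a θ))

          horizon-⊕ : ∀ a θ → T < suc (θ + τ a) → g a θ + P a θ ≡ 0
          horizon-⊕ a θ late with P a θ ℕ.≟ 0
          ... | yes P≡0 = cong₂ _+_ (horizon a θ late) P≡0
          ... | no  P≢0 = ⊥-elim (<⇒≱ late (<-≤-trans (pathFlow-horizon {Q} 0 k a θ (n≢0⇒n>0 P≢0)) travel+k≤T))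

          conserved-⊕ : ∀ v → v ≢ s → v ≢ t → ∀ θ → arriving (g ⊕ P) v θ ≡ departing (g ⊕ P) v θ
          conserved-⊕ v v≢s v≢t θ = begin
            arriving (g ⊕ P) v θ                  ≡⟨ arriving-⊕ g P v θ ⟩
            arriving g v θ + arriving P v θ       ≡⟨ cong₂ _+_ (conserved v v≢s v≢t θ) (pathFlow-conserved C k v≢s v≢t θ) ⟩
            departing g v θ + departing P v θ     ≡⟨ departing-⊕ g P v θ ⟨
            departing (g ⊕ P) v θ                 ∎
            where open ≡-Reasoning

          value-⊕ : ∑[ θ ∈ upTo T ] arriving (g ⊕ P) t θ ≡ ∑[ θ ∈ upTo T ] departing (g ⊕ P) t θ + (V + k)
          value-⊕ = begin
            ∑[ θ ∈ upTo T ] arriving (g ⊕ P) t θ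
              ≡⟨ trans (∑-cong (upTo T) (arriving-⊕ g P t)) (∑-distrib-+ (upTo T) _ _) ⟩
            ∑[ θ ∈ upTo T ] arriving g t θ + ∑[ θ ∈ upTo T ] arriving P t θ
              ≡⟨ cong₂ _+_ value (trans (∑-cong (upTo T) (pathFlow-sink C k)) (∑-distrib-+ (upTo T) _ _)) ⟩
            ∑[ θ ∈ upTo T ] departing g t θ + V + (∑[ θ ∈ upTo T ] departing P t θ + ∑[ θ ∈ upTo T ] window (travelTime Q) k θ)
              ≡⟨ cong (λ r → ∑[ θ ∈ upTo T ] departing g t θ + V + (∑[ θ ∈ upTo T ] departing P t θ + r))
                      (∑-window travel+k≤T) ⟩
            ∑[ θ ∈ upTo T ] departing g t θ + V + (∑[ θ ∈ upTo T ] departing P t θ + k)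
              ≡⟨ interchange (∑[ θ ∈ upTo T ] departing g t θ) V _ k ⟩
            ∑[ θ ∈ upTo T ] departing g t θ + ∑[ θ ∈ upTo T ] departing P t θ + (V + k)
              ≡⟨ cong (_+ (V + k)) (trans (∑-cong (upTo T) (departing-⊕ g P t)) (∑-distrib-+ (upTo T) _ _)) ⟨
            ∑[ θ ∈ upTo T ] departing (g ⊕ P) t θ + (V + k)  ∎
            where open ≡-Reasoning

          within-⊕ : ∀ a θ → x a ≡ false → g a θ + P a θ ≡ 0
          within-⊕ a θ xa≡false = cong₂ _+_ (within a θ (trans (toggleAll-∉ Q x a∉Q) xa≡false)) (pathFlow-∉ 0 k θ a∉Q)
            where
            a∉Q : a ∉ Q
            a∉Q a∈Q = case trans (sym xa≡false) (All.lookup xQ a∈Q) of λ ()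

        extend-by-path : FlowOverTimeOn x (V + k)
        extend-by-path = record
          { f = g ⊕ P ; capacity = capacity-⊕ ; horizon = horizon-⊕ ; conserved = conserved-⊕ ; value = value-⊕ ; within = within-⊕ }

      -- Each s-t path Q of x is repeated for min(c, V) time steps, where c = T − travelTime Q is its
      -- total slack by telescope.
      decompose : ∀ val {x} → IsFlow x val → Busy x → ∀ V → V ≤ weight x (slack p) → FlowOverTimeOn x V
      decompose val F busy zero _ = zeroFlow
      decompose zero {x} F busy (suc V) V<weight = ⊥-elim (<⇒≱ V<weight (subst (_≤ V) (sym weight≡0) z≤n))
        where
        weight≡0 : weight x (slack p) ≡ 0
        weight≡0 = m+n≡0⇒m≡0 _ (trans (slack+cost F busy p-s) (*-zeroʳ (p t)))
      decompose (suc val) {x} F busy (suc V) V<weight with Search.search (used? x) s t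
      ... | Search.cut R Rs Rt closed = case cut⇒value≡0 F closed Rs Rt of λ ()
      ... | Search.path P W used uniq =
        subst (FlowOverTimeOn x) (trans (+-comm (suc V ∸ c) k) (m⊓n+n∸m≡n c (suc V)))
              (extend-by-path C uniq xQ travel+k≤T (decompose val F′ busy′ (suc V ∸ c) rest≤weight))
        where
        Q = arcs P
        C = used-walk⇒connects W used
        xQ : All (λ a → x a ≡ true) Q
        xQ = map⁺ (All.map (used-true _) used)
        c = ∑ Q (slack p)
        k = c ⊓ suc V
        F′ : IsFlow (toggleAll Q x) val
        F′ = remove-isFlow (remove-shifted x C xQ uniq) F
        busy′ : Busy (toggleAll Q x)
        busy′ a xa′ with a ∈? Q
        ... | yes a∈Q = case trans (sym xa′) (trans (toggleAll-∈ x uniq a∈Q) (cong not (All.lookup xQ a∈Q))) of λ ()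
        ... | no  a∉Q = busy a (trans (sym (toggleAll-∉ Q x a∉Q)) xa′)
        travel+k≤T : travelTime Q + k ≤ T
        travel+k≤T = ≤-trans (+-monoʳ-≤ (travelTime Q) (m⊓n≤m c (suc V)))
                             (≤-reflexive (trans (sym (cong (_+ (travelTime Q + c)) p-s)) (trans (telescope C (All.map (busy _) xQ)) p-t)))
        rest≤weight : suc V ∸ c ≤ weight (toggleAll Q x) (slack p)
        rest≤weight = m≤n+o⇒m∸n≤o (suc V) c
          (≤-trans V<weight (≤-reflexive (trans (weight-toggleAll⁻ (slack p) xQ uniq) (+-comm _ c))))

      toFlowOverTime : ∀ {x V} → FlowOverTimeOn x V → FlowOverTime D s t T V
      toFlowOverTime G = record
        { f            = f
        ; capacity     = capacity
        ; horizon      = horizon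
        ; conservation = λ v v≢s v≢t θ →
            trans (inflow≡arriving f v θ) (trans (conserved v v≢s v≢t θ) (sym (outflow≡departing f v θ)))
        ; hasValue     = trans (∑-cong (upTo T) (inflow≡arriving f t))
                               (trans value (cong (_+ _) (sym (∑-cong (upTo T) (outflow≡departing f t)))))
        }
        where open FlowOverTimeOn G

    schedule⇒flowOverTime : ∀ {d Δ} (S : Schedule D d) → Feasible D S s t Δ →
                            FlowOverTime D s t (makespan D S + Δ) (d * Δ)
    schedule⇒flowOverTime {d} {Δ} S feasible =
      toFlowOverTime (decompose value isFlow (Compatible.busy compatible) (d * Δ) enough)
      where
      open PrimalDualPair (primalDual (makespan D S + Δ))
      open Invariant invariant
      open TemporallyRepeated potential source sink
      enough : d * Δ ≤ weight flow (slack potential)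
      enough = ≤-trans (trains-bound S feasible potential source (≤-reflexive (sym sink)))
                       (≤-reflexive (∑-slack≡weight compatible))

lemma23 : (D : Network) (s t : Fin (Network.n D)) → ¬ (s ≡ t) →
          (d Δ : ℕ) → 1 ≤ Δ → (OPT : ℕ) →
          IsOptimalMakespan D s t d Δ OPT →
          FlowOverTime D s t (OPT + Δ) (d * Δ)
lemma23 D s t s≢t d Δ _ OPT ((S , feasible , makespan≡OPT) , _) =
  subst (λ M → FlowOverTime D s t (M + Δ) (d * Δ)) makespan≡OPT (schedule⇒flowOverTime D s≢t S feasible)
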